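{- Let $m:\mathcal{Q}(N)\to\mathbb{R}$ be a function with $m(A,B)=0$ whenever $|B|<n-2$. Then $m$ is the M\"obius transform of a normalized (2-additive) bi-capacity on $N$ if and only if: (i) $\sum_{(A,B)\in\mathcal{Q}(N)}m(A,B)=1$, $\sum_{B\subsetneq N}m(\emptyset,B)=1$, and $m(\emptyset,N)=-1$; (ii) for all $i\in N$ and all $(A,B)\in\mathcal{Q}(N\setminus\{i\})$: (ii.1) $m(\{i\},N\setminus\{i\})+\sum_{j\in N\setminus(B\cup\{i\})}m(\{i\},N\setminus\{i,j\})+\sum_{j\in A}m(\{i,j\},N\setminus\{i,j\})\ge0$; (ii.2) $m(\emptyset,N\setminus\{i\})+\sum_{j\in N\setminus(B\cup\{i\})}m(\emptyset,N\setminus\{i,j\})+\sum_{j\in A}m(\{j\},N\setminus\{i,j\})\ge0$.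
   Context: $N=\{1,\ldots,n\}$. $\mathcal{Q}(X)=\{(A,B):A,B\subseteq X,A\cap B=\emptyset\}$; on $\mathcal{Q}(N)$, $(A,B)\sqsubseteq(C,D)$ iff $A\subseteq C$, $B\supseteq D$. A bi-capacity is an isotone $v:\mathcal{Q}(N)\to\mathbb{R}$ with $v(\emptyset,\emptyset)=0$; normalized means $v(N,\emptyset)=1$, $v(\emptyset,N)=-1$. The M\"obius transform of $v$ is $m(A,A')=\sum_{B\subseteq A}\sum_{A'\subseteq B'\subseteq N\setminus A}(-1)^{|A\setminus B|+|B'\setminus A'|}v(B,B')$, with inverse $v(A,A')=\sum_{(B,B')\sqsubseteq(A,A')}m(B,B')$. $v$ is 2-additive if $m(A,B)=0$ whenever $|B|<n-2$. -}

module Defs where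

open import Level using (0ℓ)
open import Data.Nat using (ℕ; zero; suc)
open import Data.Bool using (Bool) renaming (_≟_ to _≟ᵇ_)
open import Data.Fin using (Fin)
open import Data.Fin.Subset using (Subset; outside; inside; _∩_; ⊥; ∁; _⊆_; _─_; ∣_∣)
open import Data.Fin.Subset.Properties using (_∈?_; _⊆?_)
open import Data.Vec using ([]; _∷_)
open import Data.Vec.Properties using (≡-dec)
open import Data.List using (List; []; _∷_; _++_; map; filter; foldr; allFin; cartesianProduct; [_])
open import Data.Product using (_×_; _,_)
open import Algebra.Bundles using (CommutativeRing)
open import Relation.Binary.Structures using (IsTotalOrder)
open import Relation.Binary.PropositionalEquality using (_≡_)
open import Relation.Nullary using (¬_; Dec)
open import Relation.Nullary.Decidable using (_×-dec_)

-- Totally ordered commutative ring (the reals are an instance).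

record OrderedCommRing : Set₁ where
  field
    commRing : CommutativeRing 0ℓ 0ℓ
  open CommutativeRing commRing public
  infix 4 _≤_
  field
    _≤_          : Carrier → Carrier → Set
    isTotalOrder : IsTotalOrder _≈_ _≤_
    +-monoˡ-≤    : ∀ {x y} z → x ≤ y → (x + z) ≤ (y + z)
    *-nonneg     : ∀ {x y} → 0# ≤ x → 0# ≤ y → 0# ≤ (x * y)
    nontrivial   : ¬ (0# ≈ 1#)

subsets : (n : ℕ) → List (Subset n)
subsets zero    = [ [] ]
subsets (suc n) = map (outside ∷_) (subsets n) ++ map (inside ∷_) (subsets n)

Disjoint : ∀ {n} → Subset n → Subset n → Set
Disjoint A B = A ∩ B ≡ ⊥

disjoint? : ∀ {n} (A B : Subset n) → Dec (Disjoint A B)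
disjoint? A B = ≡-dec _≟ᵇ_ (A ∩ B) ⊥

QN : (n : ℕ) → List (Subset n × Subset n)
QN n = filter (λ p → disjoint? (Data.Product.proj₁ p) (Data.Product.proj₂ p))
              (cartesianProduct (subsets n) (subsets n))

module Bi (R : OrderedCommRing) where
  open OrderedCommRing R

  sumL : ∀ {A : Set} → List A → (A → Carrier) → Carrier
  sumL xs f = foldr (λ a acc → f a + acc) 0# xs

  sumIn : ∀ {n} → Subset n → (Fin n → Carrier) → Carrier
  sumIn {n} S f = sumL (filter (_∈? S) (allFin n)) f

  sumQ : ∀ {n} → (Subset n → Subset n → Carrier) → Carrier
  sumQ {n} f = sumL (QN n) (λ p → f (Data.Product.proj₁ p) (Data.Product.proj₂ p))

  negPow : ℕ → Carrier → Carrier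
  negPow zero    x = x
  negPow (suc k) x = - negPow k x

  möbius : ∀ {n} → (Subset n → Subset n → Carrier) → Subset n → Subset n → Carrier
  möbius {n} v A A' =
    sumL (filter (_⊆? A) (subsets n)) λ B →
    sumL (filter (λ B' → (A' ⊆? B') ×-dec (B' ⊆? ∁ A)) (subsets n)) λ B' →
    negPow (∣ A ─ B ∣ Data.Nat.+ ∣ B' ─ A' ∣) (v B B')

  IsBiCapacity : ∀ {n} → (Subset n → Subset n → Carrier) → Set
  IsBiCapacity v =
    (∀ A B C D → Disjoint A B → Disjoint C D → A ⊆ C → D ⊆ B → v A B ≤ v C D)
    × v ⊥ ⊥ ≈ 0#

  IsNormalizedBiCapacity : ∀ {n} → (Subset n → Subset n → Carrier) → Set
  IsNormalizedBiCapacity v =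
    IsBiCapacity v × v Data.Fin.Subset.⊤ ⊥ ≈ 1# × v ⊥ Data.Fin.Subset.⊤ ≈ - 1#

module Submission where

-- The Möbius transform is inverted by the zeta transform
-- zeta m (A , B) = Σ_{(C , D) ⊑ (A , B)} m (C , D), so m is the transform of a normalized
-- bi-capacity exactly when zeta m is isotone and takes the values 0, 1, −1 at (∅ , ∅),
-- (N , ∅), (∅ , N); these three values are the sums in (i). Isotonicity on Q(N) reduces to
-- the unit steps (A , B) ⊑ (A ∪ {i} , B) and (A , B ∪ {i}) ⊑ (A , B). When m is 2-additive
-- only terms m (C , D) with |D| ≥ n − 2 survive in zeta m, and the increments of zeta m
-- along the two unit steps are exactly the left-hand sides of (ii.1) and (ii.2).

open import Defs
open import Data.Nat as ℕ using (ℕ; zero; suc; _<_; _∸_; s≤s)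
import Data.Nat.Properties as ℕ
open import Data.Bool using (Bool; true; false; _∧_; _∨_)
open import Data.Bool.Properties using (∧-zeroʳ; ∨-identityʳ)
open import Data.Fin using (Fin; zero; suc)
open import Data.Fin.Subset
  using (Subset; ⊥; ⊤; ∁; ⁅_⁆; _∪_; _∩_; _∉_; _∈_; ∣_∣; _⊆_; _─_; inside; outside)
open import Data.Fin.Subset.Properties
  using (_⊂?_; _⊆?_; _∈?_; ∣p∣≤n; ∣⊤∣≡n; x∈∁p⇒x∉p; p⊆p∪q; q⊆p∪q; x∈⁅x⁆;
         ∪-identityˡ; ∪-identityʳ; ∩-zeroˡ; ∩-zeroʳ; drop-∷-⊆; drop-there)
open import Data.Vec using (_∷_; []; here; there)
open import Data.Vec.Properties using (∷-injectiveˡ; ∷-injectiveʳ)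
open import Data.List using (List; []; _∷_; _++_; map; filter; tabulate; cartesianProduct)
open import Data.List.Properties using (filter-++)
open import Data.Empty using (⊥-elim)
open import Data.Product using (Σ; _×_; _,_; proj₁; proj₂)
open import Function using (_∘_; id)
open import Function.Bundles using (_⇔_; mk⇔; Equivalence)
open import Relation.Nullary using (does; ¬_)
open import Relation.Nullary.Decidable using (_×-dec_)
open import Relation.Unary using (Pred; Decidable)
open import Relation.Binary.Structures using (IsTotalOrder)
open import Relation.Binary.PropositionalEquality as P using (_≡_; cong; cong₂)

∁⊥≡⊤ : ∀ {n} → ∁ {n} ⊥ ≡ ⊤
∁⊥≡⊤ {zero}  = P.refl
∁⊥≡⊤ {suc n} = cong (true ∷_) ∁⊥≡⊤

slice : ∀ {n} {C : Set} → Bool → Bool →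
        (Subset (suc n) → Subset (suc n) → C) → Subset n → Subset n → C
slice x y v X Y = v (x ∷ X) (y ∷ Y)

¬disjoint-inside : ∀ {n} {A B : Subset n} → ¬ Disjoint (inside ∷ A) (inside ∷ B)
¬disjoint-inside d with ∷-injectiveˡ d
... | ()

disjoint-∁ : ∀ {n} (T : Subset n) → Disjoint T (∁ T)
disjoint-∁ []          = P.refl
disjoint-∁ (true ∷ T)  = cong (false ∷_) (disjoint-∁ T)
disjoint-∁ (false ∷ T) = cong (false ∷_) (disjoint-∁ T)

disjoint-∁-∪ˡ : ∀ {n} (T U : Subset n) → Disjoint T (∁ (T ∪ U))
disjoint-∁-∪ˡ []          []      = P.refl
disjoint-∁-∪ˡ (true ∷ T)  (_ ∷ U) = cong (false ∷_) (disjoint-∁-∪ˡ T U)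
disjoint-∁-∪ˡ (false ∷ T) (_ ∷ U) = cong (false ∷_) (disjoint-∁-∪ˡ T U)

disjoint-∁-∪ʳ : ∀ {n} (T U : Subset n) → Disjoint U (∁ (T ∪ U))
disjoint-∁-∪ʳ []          []          = P.refl
disjoint-∁-∪ʳ (t ∷ T)     (false ∷ U) = cong (false ∷_) (disjoint-∁-∪ʳ T U)
disjoint-∁-∪ʳ (true ∷ T)  (true ∷ U)  = cong (false ∷_) (disjoint-∁-∪ʳ T U)
disjoint-∁-∪ʳ (false ∷ T) (true ∷ U)  = cong (false ∷_) (disjoint-∁-∪ʳ T U)

disjoint-∪⁅⁆ˡ : ∀ {n} {i : Fin n} {A B : Subset n} → Disjoint A B → i ∉ B → Disjoint (A ∪ ⁅ i ⁆) B
disjoint-∪⁅⁆ˡ {i = zero} {a ∷ A} {true ∷ B} d i∉B = ⊥-elim (i∉B here)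
disjoint-∪⁅⁆ˡ {i = zero} {a ∷ A} {false ∷ B} d i∉B =
  cong₂ _∷_ (∧-zeroʳ (a ∨ true)) (P.trans (cong (_∩ B) (∪-identityʳ A)) (∷-injectiveʳ d))
disjoint-∪⁅⁆ˡ {i = suc i} {a ∷ A} {b ∷ B} d i∉B =
  cong₂ _∷_ (P.trans (cong (_∧ b) (∨-identityʳ a)) (∷-injectiveˡ d))
            (disjoint-∪⁅⁆ˡ (∷-injectiveʳ d) (i∉B ∘ there))

disjoint-∪⁅⁆ʳ : ∀ {n} {i : Fin n} {A B : Subset n} → Disjoint A B → i ∉ A → Disjoint A (B ∪ ⁅ i ⁆)
disjoint-∪⁅⁆ʳ {i = zero} {true ∷ A} {b ∷ B} d i∉A = ⊥-elim (i∉A here)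
disjoint-∪⁅⁆ʳ {i = zero} {false ∷ A} {b ∷ B} d i∉A =
  cong (false ∷_) (P.trans (cong (A ∩_) (∪-identityʳ B)) (∷-injectiveʳ d))
disjoint-∪⁅⁆ʳ {i = suc i} {a ∷ A} {b ∷ B} d i∉A =
  cong₂ _∷_ (P.trans (cong (a ∧_) (∨-identityʳ b)) (∷-injectiveˡ d))
            (disjoint-∪⁅⁆ʳ (∷-injectiveʳ d) (i∉A ∘ there))

suc∣∁⁅x⁆∣≡n : ∀ {n} (x : Fin n) → suc ∣ ∁ ⁅ x ⁆ ∣ ≡ n
suc∣∁⁅x⁆∣≡n {suc n} zero    = cong suc (P.trans (cong ∣_∣ (∁⊥≡⊤ {n})) (∣⊤∣≡n n))
suc∣∁⁅x⁆∣≡n {suc n} (suc x) = cong suc (suc∣∁⁅x⁆∣≡n x)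

2+∣∁[⁅x⁆∪⁅y⁆]∣≡n : ∀ {n} (x y : Fin n) → ¬ x ≡ y → 2 ℕ.+ ∣ ∁ (⁅ x ⁆ ∪ ⁅ y ⁆) ∣ ≡ n
2+∣∁[⁅x⁆∪⁅y⁆]∣≡n zero zero x≢y = ⊥-elim (x≢y P.refl)
2+∣∁[⁅x⁆∪⁅y⁆]∣≡n {suc n} zero (suc y) _ =
  cong suc (P.trans (cong (λ S → suc ∣ ∁ S ∣) (∪-identityˡ ⁅ y ⁆)) (suc∣∁⁅x⁆∣≡n y))
2+∣∁[⁅x⁆∪⁅y⁆]∣≡n {suc n} (suc x) zero _ =
  cong suc (P.trans (cong (λ S → suc ∣ ∁ S ∣) (∪-identityʳ ⁅ x ⁆)) (suc∣∁⁅x⁆∣≡n x))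
2+∣∁[⁅x⁆∪⁅y⁆]∣≡n {suc n} (suc x) (suc y) x≢y =
  cong suc (2+∣∁[⁅x⁆∪⁅y⁆]∣≡n x y (x≢y ∘ cong suc))

x∈∁[p∪⁅y⁆]⇒x≢y : ∀ {n} {x y : Fin n} (p : Subset n) → x ∈ ∁ (p ∪ ⁅ y ⁆) → ¬ x ≡ y
x∈∁[p∪⁅y⁆]⇒x≢y {y = y} p x∈ P.refl = x∈∁p⇒x∉p x∈ (q⊆p∪q p ⁅ y ⁆ (x∈⁅x⁆ y))

2+m<n⇒m<n∸2 : ∀ {m n} → 2 ℕ.+ m < n → m < n ∸ 2
2+m<n⇒m<n∸2 {n = suc (suc n)} (s≤s (s≤s m<n)) = m<n

does-⊆?-⊤ : ∀ {n} (X : Subset n) → does (X ⊆? ⊤) ≡ true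
does-⊆?-⊤ []          = P.refl
does-⊆?-⊤ (true ∷ X)  = does-⊆?-⊤ X
does-⊆?-⊤ (false ∷ X) = does-⊆?-⊤ X

module _ {A : Set} where

  filter-does-cong : ∀ {p q} {P : Pred A p} {Q : Pred A q} (P? : Decidable P) (Q? : Decidable Q) xs →
                     (∀ x → does (P? x) ≡ does (Q? x)) → filter P? xs ≡ filter Q? xs
  filter-does-cong P? Q? []       e = P.refl
  filter-does-cong P? Q? (x ∷ xs) e with does (P? x) | does (Q? x) | e x
  ... | true  | .true  | P.refl = cong (x ∷_) (filter-does-cong P? Q? xs e)
  ... | false | .false | P.refl = filter-does-cong P? Q? xs e

  filter-does-false : ∀ {p} {P : Pred A p} (P? : Decidable P) xs →
                      (∀ x → does (P? x) ≡ false) → filter P? xs ≡ []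
  filter-does-false P? []       e = P.refl
  filter-does-false P? (x ∷ xs) e with does (P? x) | e x
  ... | false | P.refl = filter-does-false P? xs e

  filter-does-true : ∀ {p} {P : Pred A p} (P? : Decidable P) xs →
                     (∀ x → does (P? x) ≡ true) → filter P? xs ≡ xs
  filter-does-true P? []       e = P.refl
  filter-does-true P? (x ∷ xs) e with does (P? x) | e x
  ... | true | P.refl = cong (x ∷_) (filter-does-true P? xs e)

  filter-map : ∀ {B : Set} {p} {P : Pred B p} (P? : Decidable P) (g : A → B) xs →
               filter P? (map g xs) ≡ map g (filter (P? ∘ g) xs)
  filter-map P? g []       = P.refl
  filter-map P? g (x ∷ xs) with does (P? (g x))
  ... | true  = cong (g x ∷_) (filter-map P? g xs)
  ... | false = filter-map P? g xs

module _ (R : OrderedCommRing) where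

  open OrderedCommRing R hiding (zero)
  open Bi R
  open import Relation.Binary.Reasoning.Setoid setoid
  open import Algebra.Properties.AbelianGroup +-abelianGroup
    using (xyx⁻¹≈y; ⁻¹-∙-comm; ε⁻¹≈ε; inverseˡ-unique; ⁻¹-involutive)
  open import Algebra.Properties.CommutativeSemigroup +-commutativeSemigroup using (interchange)
  open import Algebra.Solver.CommutativeMonoid +-commutativeMonoid using (solve; _⊜_; _⊕_)
  private module O = IsTotalOrder isTotalOrder

  sumL-cong : ∀ {A : Set} (xs : List A) {f g : A → Carrier} → (∀ x → f x ≈ g x) → sumL xs f ≈ sumL xs g
  sumL-cong []       f≈g = refl
  sumL-cong (x ∷ xs) f≈g = +-cong (f≈g x) (sumL-cong xs f≈g)

  sumL-++ : ∀ {A : Set} (xs ys : List A) (f : A → Carrier) → sumL (xs ++ ys) f ≈ sumL xs f + sumL ys f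
  sumL-++ []       ys f = sym (+-identityˡ _)
  sumL-++ (x ∷ xs) ys f = trans (+-cong refl (sumL-++ xs ys f)) (sym (+-assoc _ _ _))

  sumL-map : ∀ {A B : Set} (g : A → B) (xs : List A) (f : B → Carrier) → sumL (map g xs) f ≡ sumL xs (f ∘ g)
  sumL-map g []       f = P.refl
  sumL-map g (x ∷ xs) f = cong (f (g x) +_) (sumL-map g xs f)

  sumL-+ : ∀ {A : Set} (xs : List A) (f g : A → Carrier) →
           sumL xs (λ x → f x + g x) ≈ sumL xs f + sumL xs g
  sumL-+ []       f g = sym (+-identityˡ _)
  sumL-+ (x ∷ xs) f g = trans (+-cong refl (sumL-+ xs f g)) (interchange _ _ _ _)

  sumL-neg : ∀ {A : Set} (xs : List A) (f : A → Carrier) → sumL xs (λ x → - f x) ≈ - sumL xs f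
  sumL-neg []       f = sym ε⁻¹≈ε
  sumL-neg (x ∷ xs) f = trans (+-cong refl (sumL-neg xs f)) (⁻¹-∙-comm _ _)

  sumL-filter-cartesianProduct :
    ∀ {A B : Set} {p} {P : Pred (A × B) p} (P? : Decidable P) (xs : List A) (ys : List B) (h : A × B → Carrier) →
    sumL (filter P? (cartesianProduct xs ys)) h ≈ sumL xs (λ a → sumL (filter (λ b → P? (a , b)) ys) (λ b → h (a , b)))
  sumL-filter-cartesianProduct P? []       ys h = refl
  sumL-filter-cartesianProduct P? (x ∷ xs) ys h = begin
      sumL (filter P? (map (x ,_) ys ++ cartesianProduct xs ys)) h
    ≡⟨ cong (λ l → sumL l h) (filter-++ P? (map (x ,_) ys) (cartesianProduct xs ys)) ⟩
      sumL (filter P? (map (x ,_) ys) ++ filter P? (cartesianProduct xs ys)) h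
    ≈⟨ sumL-++ (filter P? (map (x ,_) ys)) _ h ⟩
      sumL (filter P? (map (x ,_) ys)) h + sumL (filter P? (cartesianProduct xs ys)) h
    ≈⟨ +-cong (reflexive (P.trans (cong (λ l → sumL l h) (filter-map P? (x ,_) ys))
                                  (sumL-map (x ,_) (filter (λ b → P? (x , b)) ys) h)))
              (sumL-filter-cartesianProduct P? xs ys h) ⟩
      _ ∎

  sumL-filter-subsets-suc :
    ∀ {n p} {P : Pred (Subset (suc n)) p} (P? : Decidable P) (f : Subset (suc n) → Carrier) →
    sumL (filter P? (subsets (suc n))) f ≈
      sumL (filter (P? ∘ (outside ∷_)) (subsets n)) (f ∘ (outside ∷_)) +
      sumL (filter (P? ∘ (inside ∷_)) (subsets n)) (f ∘ (inside ∷_))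
  sumL-filter-subsets-suc {n} P? f = begin
      sumL (filter P? (map (outside ∷_) (subsets n) ++ map (inside ∷_) (subsets n))) f
    ≡⟨ cong (λ l → sumL l f) (filter-++ P? (map (outside ∷_) (subsets n)) (map (inside ∷_) (subsets n))) ⟩
      sumL (filter P? (map (outside ∷_) (subsets n)) ++ filter P? (map (inside ∷_) (subsets n))) f
    ≈⟨ sumL-++ (filter P? (map (outside ∷_) (subsets n))) (filter P? (map (inside ∷_) (subsets n))) f ⟩
      sumL (filter P? (map (outside ∷_) (subsets n))) f + sumL (filter P? (map (inside ∷_) (subsets n))) f
    ≡⟨ cong₂ _+_ (half outside) (half inside) ⟩
      _ ∎
    where
      half : ∀ x → sumL (filter P? (map (x ∷_) (subsets n))) f ≡
                   sumL (filter (P? ∘ (x ∷_)) (subsets n)) (f ∘ (x ∷_))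
      half x = P.trans (cong (λ l → sumL l f) (filter-map P? (x ∷_) (subsets n)))
                       (sumL-map (x ∷_) (filter (P? ∘ (x ∷_)) (subsets n)) f)

  sumL-subsets-suc : ∀ {n} (f : Subset (suc n) → Carrier) →
    sumL (subsets (suc n)) f ≈ sumL (subsets n) (f ∘ (outside ∷_)) + sumL (subsets n) (f ∘ (inside ∷_))
  sumL-subsets-suc {n} f =
    trans (sumL-++ (map (outside ∷_) (subsets n)) (map (inside ∷_) (subsets n)) f)
          (reflexive (cong₂ _+_ (sumL-map (outside ∷_) (subsets n) f) (sumL-map (inside ∷_) (subsets n) f)))

  sumL-⊂⊤+⊤ : ∀ {n} (f : Subset n → Carrier) → sumL (filter (_⊂? ⊤) (subsets n)) f + f ⊤ ≈ sumL (subsets n) f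
  sumL-⊂⊤+⊤ {zero}  f = +-comm _ _
  sumL-⊂⊤+⊤ {suc n} f = begin
      sumL (filter (_⊂? ⊤) (subsets (suc n))) f + f ⊤
    ≈⟨ +-cong (sumL-filter-subsets-suc (_⊂? ⊤) f) refl ⟩
      sumL (filter (λ X → (outside ∷ X) ⊂? ⊤) (subsets n)) (f ∘ (outside ∷_))
        + sumL (filter (λ X → (inside ∷ X) ⊂? ⊤) (subsets n)) (f ∘ (inside ∷_)) + f ⊤
    ≡⟨ cong₂ (λ l l' → sumL l (f ∘ (outside ∷_)) + sumL l' (f ∘ (inside ∷_)) + f ⊤)
             (filter-does-true _ (subsets n) does-⊆?-⊤)
             (filter-does-cong _ (_⊂? ⊤) (subsets n) (λ _ → P.refl)) ⟩
      sumL (subsets n) (f ∘ (outside ∷_)) + sumL (filter (_⊂? ⊤) (subsets n)) (f ∘ (inside ∷_)) + f ⊤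
    ≈⟨ +-assoc _ _ _ ⟩
      sumL (subsets n) (f ∘ (outside ∷_)) + (sumL (filter (_⊂? ⊤) (subsets n)) (f ∘ (inside ∷_)) + f ⊤)
    ≈⟨ +-cong refl (sumL-⊂⊤+⊤ (f ∘ (inside ∷_))) ⟩
      sumL (subsets n) (f ∘ (outside ∷_)) + sumL (subsets n) (f ∘ (inside ∷_))
    ≈⟨ sym (sumL-subsets-suc f) ⟩
      sumL (subsets (suc n)) f ∎

  sumIn-tabulate-suc : ∀ {k n} (x : Bool) (S : Subset n) (h : Fin k → Fin n) (f : Fin (suc n) → Carrier) →
    sumL (filter (_∈? (x ∷ S)) (tabulate (suc ∘ h))) f ≡ sumL (filter (_∈? S) (tabulate h)) (f ∘ suc)
  sumIn-tabulate-suc {zero}  x S h f = P.refl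
  sumIn-tabulate-suc {suc k} x S h f with does (h zero ∈? S)
  ... | true  = cong (f (suc (h zero)) +_) (sumIn-tabulate-suc x S (h ∘ suc) f)
  ... | false = sumIn-tabulate-suc x S (h ∘ suc) f

  sumIn-outside∷ : ∀ {n} (S : Subset n) (f : Fin (suc n) → Carrier) → sumIn (outside ∷ S) f ≡ sumIn S (f ∘ suc)
  sumIn-outside∷ S f = sumIn-tabulate-suc outside S id f

  sumIn-inside∷ : ∀ {n} (S : Subset n) (f : Fin (suc n) → Carrier) →
                  sumIn (inside ∷ S) f ≡ f zero + sumIn S (f ∘ suc)
  sumIn-inside∷ S f = cong (f zero +_) (sumIn-tabulate-suc inside S id f)

  sumIn-cong : ∀ {n} (S : Subset n) {f g : Fin n → Carrier} →
               (∀ j → j ∈ S → f j ≈ g j) → sumIn S f ≈ sumIn S g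
  sumIn-cong {zero}  []            f≈g = refl
  sumIn-cong {suc n} (outside ∷ S) {f} {g} f≈g = begin
    sumIn (outside ∷ S) f  ≡⟨ sumIn-outside∷ S f ⟩
    sumIn S (f ∘ suc)      ≈⟨ sumIn-cong S (λ j j∈S → f≈g (suc j) (there j∈S)) ⟩
    sumIn S (g ∘ suc)      ≡⟨ sumIn-outside∷ S g ⟨
    sumIn (outside ∷ S) g  ∎
  sumIn-cong {suc n} (inside ∷ S) {f} {g} f≈g = begin
    sumIn (inside ∷ S) f       ≡⟨ sumIn-inside∷ S f ⟩
    f zero + sumIn S (f ∘ suc) ≈⟨ +-cong (f≈g zero here) (sumIn-cong S (λ j j∈S → f≈g (suc j) (there j∈S))) ⟩
    g zero + sumIn S (g ∘ suc) ≡⟨ sumIn-inside∷ S g ⟨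
    sumIn (inside ∷ S) g       ∎

  sumIn-≈0 : ∀ {n} (S : Subset n) (f : Fin n → Carrier) → (∀ j → j ∈ S → f j ≈ 0#) → sumIn S f ≈ 0#
  sumIn-≈0 {zero}  []            f f≈0 = refl
  sumIn-≈0 {suc n} (outside ∷ S) f f≈0 =
    trans (reflexive (sumIn-outside∷ S f)) (sumIn-≈0 S _ (λ j j∈S → f≈0 (suc j) (there j∈S)))
  sumIn-≈0 {suc n} (inside ∷ S) f f≈0 =
    trans (reflexive (sumIn-inside∷ S f))
          (trans (+-cong (f≈0 zero here) (sumIn-≈0 S _ (λ j j∈S → f≈0 (suc j) (there j∈S)))) (+-identityˡ _))

  -- Slicing the Möbius transform along the first coordinate

  negPow-+ : ∀ k x y → negPow k (x + y) ≈ negPow k x + negPow k y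
  negPow-+ zero    x y = refl
  negPow-+ (suc k) x y = trans (-‿cong (negPow-+ k x y)) (sym (⁻¹-∙-comm _ _))

  innerRange? : ∀ {n} (A A' : Subset n) → Decidable (λ B' → (A' ⊆ B') × (B' ⊆ ∁ A))
  innerRange? A A' B' = (A' ⊆? B') ×-dec (B' ⊆? ∁ A)

  -- möbius v A A' is definitionally the sum of signedSum A A' ∣ A ─ B ∣ (v B) over B ⊆ A.
  signedSum : ∀ {n} (A A' : Subset n) → ℕ → (Subset n → Carrier) → Carrier
  signedSum {n} A A' k w = sumL (filter (innerRange? A A') (subsets n)) λ B' → negPow (k ℕ.+ ∣ B' ─ A' ∣) (w B')

  signedSum-suc : ∀ {n} (A A' : Subset n) k w → signedSum A A' (suc k) w ≈ - signedSum A A' k w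
  signedSum-suc {n} A A' k w = sumL-neg (filter (innerRange? A A') (subsets n)) _

  -- The suffixes io, oo, oi name the heads (inside/outside) of the two subsets.
  signedSum-io : ∀ {n} (A A' : Subset n) k (w : Subset (suc n) → Carrier) →
    signedSum (inside ∷ A) (outside ∷ A') k w ≈ signedSum A A' k (w ∘ (outside ∷_))
  signedSum-io {n} A A' k w = begin
      signedSum (inside ∷ A) (outside ∷ A') k w
    ≈⟨ sumL-filter-subsets-suc (innerRange? (inside ∷ A) (outside ∷ A')) _ ⟩
      sumL (filter (innerRange? (inside ∷ A) (outside ∷ A') ∘ (outside ∷_)) (subsets n)) _
      + sumL (filter (innerRange? (inside ∷ A) (outside ∷ A') ∘ (inside ∷_)) (subsets n)) _
    ≡⟨ cong₂ (λ l l' → sumL l _ + sumL l' _)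
             (filter-does-cong _ (innerRange? A A') (subsets n) (λ _ → P.refl))
             (filter-does-false _ (subsets n) (λ Y → ∧-zeroʳ (does (A' ⊆? Y)))) ⟩
      signedSum A A' k (w ∘ (outside ∷_)) + 0#
    ≈⟨ +-identityʳ _ ⟩
      signedSum A A' k (w ∘ (outside ∷_)) ∎

  signedSum-oo : ∀ {n} (A A' : Subset n) k (w : Subset (suc n) → Carrier) →
    signedSum (outside ∷ A) (outside ∷ A') k w ≈
      signedSum A A' k (w ∘ (outside ∷_)) - signedSum A A' k (w ∘ (inside ∷_))
  signedSum-oo {n} A A' k w = begin
      signedSum (outside ∷ A) (outside ∷ A') k w
    ≈⟨ sumL-filter-subsets-suc (innerRange? (outside ∷ A) (outside ∷ A')) _ ⟩
      sumL (filter (innerRange? (outside ∷ A) (outside ∷ A') ∘ (outside ∷_)) (subsets n)) _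
      + sumL (filter (innerRange? (outside ∷ A) (outside ∷ A') ∘ (inside ∷_)) (subsets n)) _
    ≡⟨ cong₂ (λ l l' → sumL l _ + sumL l' _)
             (filter-does-cong _ (innerRange? A A') (subsets n) (λ _ → P.refl))
             (filter-does-cong _ (innerRange? A A') (subsets n) (λ _ → P.refl)) ⟩
      signedSum A A' k (w ∘ (outside ∷_))
      + sumL (filter (innerRange? A A') (subsets n)) (λ Y → negPow (k ℕ.+ suc ∣ Y ─ A' ∣) (w (inside ∷ Y)))
    ≈⟨ +-cong refl (sumL-cong (filter (innerRange? A A') (subsets n))
                     (λ Y → reflexive (cong (λ e → negPow e (w (inside ∷ Y))) (ℕ.+-suc k ∣ Y ─ A' ∣)))) ⟩
      signedSum A A' k (w ∘ (outside ∷_)) + signedSum A A' (suc k) (w ∘ (inside ∷_))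
    ≈⟨ +-cong refl (signedSum-suc A A' k (w ∘ (inside ∷_))) ⟩
      signedSum A A' k (w ∘ (outside ∷_)) - signedSum A A' k (w ∘ (inside ∷_)) ∎

  signedSum-oi : ∀ {n} (A A' : Subset n) k (w : Subset (suc n) → Carrier) →
    signedSum (outside ∷ A) (inside ∷ A') k w ≈ signedSum A A' k (w ∘ (inside ∷_))
  signedSum-oi {n} A A' k w = begin
      signedSum (outside ∷ A) (inside ∷ A') k w
    ≈⟨ sumL-filter-subsets-suc (innerRange? (outside ∷ A) (inside ∷ A')) _ ⟩
      sumL (filter (innerRange? (outside ∷ A) (inside ∷ A') ∘ (outside ∷_)) (subsets n)) _
      + sumL (filter (innerRange? (outside ∷ A) (inside ∷ A') ∘ (inside ∷_)) (subsets n)) _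
    ≡⟨ cong₂ (λ l l' → sumL l _ + sumL l' _)
             (filter-does-false _ (subsets n) (λ _ → P.refl))
             (filter-does-cong _ (innerRange? A A') (subsets n) (λ _ → P.refl)) ⟩
      0# + signedSum A A' k (w ∘ (inside ∷_))
    ≈⟨ +-identityˡ _ ⟩
      signedSum A A' k (w ∘ (inside ∷_)) ∎

  möbius-io : ∀ {n} (v : Subset (suc n) → Subset (suc n) → Carrier) (A A' : Subset n) →
    möbius v (inside ∷ A) (outside ∷ A') ≈ möbius (slice inside outside v) A A' - möbius (slice outside outside v) A A'
  möbius-io {n} v A A' = begin
      möbius v (inside ∷ A) (outside ∷ A')
    ≈⟨ sumL-filter-subsets-suc (_⊆? (inside ∷ A)) _ ⟩
      sumL (filter (λ X → (outside ∷ X) ⊆? (inside ∷ A)) (subsets n)) (λ X → inner (outside ∷ X))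
      + sumL (filter (λ X → (inside ∷ X) ⊆? (inside ∷ A)) (subsets n)) (λ X → inner (inside ∷ X))
    ≡⟨ cong₂ (λ l l' → sumL l (λ X → inner (outside ∷ X)) + sumL l' (λ X → inner (inside ∷ X)))
             (filter-does-cong _ (_⊆? A) (subsets n) (λ _ → P.refl))
             (filter-does-cong _ (_⊆? A) (subsets n) (λ _ → P.refl)) ⟩
      sumL F (λ X → inner (outside ∷ X)) + sumL F (λ X → inner (inside ∷ X))
    ≈⟨ +-cong (sumL-cong F (λ X → trans (signedSum-io A A' (suc ∣ A ─ X ∣) (v (outside ∷ X)))
                                         (signedSum-suc A A' ∣ A ─ X ∣ _)))
              (sumL-cong F (λ X → signedSum-io A A' ∣ A ─ X ∣ (v (inside ∷ X)))) ⟩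
      sumL F (λ X → - signedSum A A' ∣ A ─ X ∣ (slice outside outside v X)) + möbius (slice inside outside v) A A'
    ≈⟨ +-cong (sumL-neg F _) refl ⟩
      - möbius (slice outside outside v) A A' + möbius (slice inside outside v) A A'
    ≈⟨ +-comm _ _ ⟩
      möbius (slice inside outside v) A A' - möbius (slice outside outside v) A A' ∎
    where
      F = filter (_⊆? A) (subsets n)
      inner : Subset (suc n) → Carrier
      inner B = signedSum (inside ∷ A) (outside ∷ A') ∣ (inside ∷ A) ─ B ∣ (v B)

  möbius-oo : ∀ {n} (v : Subset (suc n) → Subset (suc n) → Carrier) (A A' : Subset n) →
    möbius v (outside ∷ A) (outside ∷ A') ≈ möbius (slice outside outside v) A A' - möbius (slice outside inside v) A A'
  möbius-oo {n} v A A' = begin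
      möbius v (outside ∷ A) (outside ∷ A')
    ≈⟨ sumL-filter-subsets-suc (_⊆? (outside ∷ A)) _ ⟩
      sumL (filter (λ X → (outside ∷ X) ⊆? (outside ∷ A)) (subsets n)) (λ X → inner (outside ∷ X))
      + sumL (filter (λ X → (inside ∷ X) ⊆? (outside ∷ A)) (subsets n)) (λ X → inner (inside ∷ X))
    ≡⟨ cong₂ (λ l l' → sumL l (λ X → inner (outside ∷ X)) + sumL l' (λ X → inner (inside ∷ X)))
             (filter-does-cong _ (_⊆? A) (subsets n) (λ _ → P.refl))
             (filter-does-false _ (subsets n) (λ _ → P.refl)) ⟩
      sumL F (λ X → inner (outside ∷ X)) + 0#
    ≈⟨ +-identityʳ _ ⟩
      sumL F (λ X → inner (outside ∷ X))
    ≈⟨ sumL-cong F (λ X → signedSum-oo A A' ∣ A ─ X ∣ (v (outside ∷ X))) ⟩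
      sumL F (λ X → (signedSum A A' ∣ A ─ X ∣ (slice outside outside v X))
                    - (signedSum A A' ∣ A ─ X ∣ (slice outside inside v X)))
    ≈⟨ sumL-+ F _ _ ⟩
      möbius (slice outside outside v) A A' + sumL F (λ X → - signedSum A A' ∣ A ─ X ∣ (slice outside inside v X))
    ≈⟨ +-cong refl (sumL-neg F _) ⟩
      möbius (slice outside outside v) A A' - möbius (slice outside inside v) A A' ∎
    where
      F = filter (_⊆? A) (subsets n)
      inner : Subset (suc n) → Carrier
      inner B = signedSum (outside ∷ A) (outside ∷ A') ∣ (outside ∷ A) ─ B ∣ (v B)

  möbius-oi : ∀ {n} (v : Subset (suc n) → Subset (suc n) → Carrier) (A A' : Subset n) →
    möbius v (outside ∷ A) (inside ∷ A') ≈ möbius (slice outside inside v) A A'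
  möbius-oi {n} v A A' = begin
      möbius v (outside ∷ A) (inside ∷ A')
    ≈⟨ sumL-filter-subsets-suc (_⊆? (outside ∷ A)) _ ⟩
      sumL (filter (λ X → (outside ∷ X) ⊆? (outside ∷ A)) (subsets n)) (λ X → inner (outside ∷ X))
      + sumL (filter (λ X → (inside ∷ X) ⊆? (outside ∷ A)) (subsets n)) (λ X → inner (inside ∷ X))
    ≡⟨ cong₂ (λ l l' → sumL l (λ X → inner (outside ∷ X)) + sumL l' (λ X → inner (inside ∷ X)))
             (filter-does-cong _ (_⊆? A) (subsets n) (λ _ → P.refl))
             (filter-does-false _ (subsets n) (λ _ → P.refl)) ⟩
      sumL F (λ X → inner (outside ∷ X)) + 0#
    ≈⟨ +-identityʳ _ ⟩
      sumL F (λ X → inner (outside ∷ X))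
    ≈⟨ sumL-cong F (λ X → signedSum-oi A A' ∣ A ─ X ∣ (v (outside ∷ X))) ⟩
      möbius (slice outside inside v) A A' ∎
    where
      F = filter (_⊆? A) (subsets n)
      inner : Subset (suc n) → Carrier
      inner B = signedSum (outside ∷ A) (inside ∷ A') ∣ (outside ∷ A) ─ B ∣ (v B)

  möbius-+ : ∀ {n} (f g : Subset n → Subset n → Carrier) (A A' : Subset n) →
    möbius (λ X Y → f X Y + g X Y) A A' ≈ möbius f A A' + möbius g A A'
  möbius-+ {n} f g A A' =
    trans (sumL-cong (filter (_⊆? A) (subsets n)) (λ X →
             trans (sumL-cong (filter (innerRange? A A') (subsets n))
                              (λ Y → negPow-+ (∣ A ─ X ∣ ℕ.+ ∣ Y ─ A' ∣) (f X Y) (g X Y)))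
                   (sumL-+ (filter (innerRange? A A') (subsets n)) _ _)))
          (sumL-+ (filter (_⊆? A) (subsets n)) _ _)

  möbius-[] : (v : Subset 0 → Subset 0 → Carrier) → möbius v [] [] ≈ v [] []
  möbius-[] v = trans (+-identityʳ _) (+-identityʳ _)

  -- The zeta transform

  -- Each clause sums over the heads (x' , y') ⊑ (x , y) of disjoint pairs; the last clause
  -- is a junk value on a non-disjoint pair.
  zeta : ∀ {n} → (Subset n → Subset n → Carrier) → Subset n → Subset n → Carrier
  zeta {zero}  m []            []            = m [] []
  zeta {suc n} m (outside ∷ A) (inside ∷ B)  = zeta (slice outside inside m) A B
  zeta {suc n} m (outside ∷ A) (outside ∷ B) = zeta (slice outside inside m) A B + zeta (slice outside outside m) A B
  zeta {suc n} m (inside ∷ A)  (outside ∷ B) =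
    zeta (slice outside inside m) A B + zeta (slice outside outside m) A B + zeta (slice inside outside m) A B
  zeta {suc n} m (inside ∷ A)  (inside ∷ B)  = 0#

  zeta-cong : ∀ {n} {f g : Subset n → Subset n → Carrier} → (∀ X Y → Disjoint X Y → f X Y ≈ g X Y) →
              ∀ A B → Disjoint A B → zeta f A B ≈ zeta g A B
  zeta-cong {zero}  f≈g []            []            d = f≈g [] [] d
  zeta-cong {suc n} f≈g (outside ∷ A) (inside ∷ B)  d =
    zeta-cong (λ X Y e → f≈g _ _ (cong (outside ∷_) e)) A B (∷-injectiveʳ d)
  zeta-cong {suc n} f≈g (outside ∷ A) (outside ∷ B) d =
    +-cong (zeta-cong (λ X Y e → f≈g _ _ (cong (outside ∷_) e)) A B (∷-injectiveʳ d))
           (zeta-cong (λ X Y e → f≈g _ _ (cong (outside ∷_) e)) A B (∷-injectiveʳ d))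
  zeta-cong {suc n} f≈g (inside ∷ A)  (outside ∷ B) d =
    +-cong (+-cong (zeta-cong (λ X Y e → f≈g _ _ (cong (outside ∷_) e)) A B (∷-injectiveʳ d))
                   (zeta-cong (λ X Y e → f≈g _ _ (cong (outside ∷_) e)) A B (∷-injectiveʳ d)))
           (zeta-cong (λ X Y e → f≈g _ _ (cong (outside ∷_) e)) A B (∷-injectiveʳ d))
  zeta-cong {suc n} f≈g (inside ∷ A)  (inside ∷ B)  d = refl

  zeta-0# : ∀ {n} A B → zeta {n} (λ _ _ → 0#) A B ≈ 0#
  zeta-0# {zero}  []            []            = refl
  zeta-0# {suc n} (outside ∷ A) (inside ∷ B)  = zeta-0# A B
  zeta-0# {suc n} (outside ∷ A) (outside ∷ B) = trans (+-cong (zeta-0# A B) (zeta-0# A B)) (+-identityʳ _)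
  zeta-0# {suc n} (inside ∷ A)  (outside ∷ B) =
    trans (+-cong (trans (+-cong (zeta-0# A B) (zeta-0# A B)) (+-identityʳ _)) (zeta-0# A B)) (+-identityʳ _)
  zeta-0# {suc n} (inside ∷ A)  (inside ∷ B)  = refl

  zeta-≈0 : ∀ {n} {m : Subset n → Subset n → Carrier} → (∀ X Y → Disjoint X Y → m X Y ≈ 0#) →
            ∀ A B → Disjoint A B → zeta m A B ≈ 0#
  zeta-≈0 m≈0 A B d = trans (zeta-cong m≈0 A B d) (zeta-0# A B)

  zeta-+ : ∀ {n} (f g : Subset n → Subset n → Carrier) A B →
           zeta (λ X Y → f X Y + g X Y) A B ≈ zeta f A B + zeta g A B
  zeta-+ {zero}  f g []            []            = refl
  zeta-+ {suc n} f g (outside ∷ A) (inside ∷ B)  = zeta-+ _ _ A B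
  zeta-+ {suc n} f g (outside ∷ A) (outside ∷ B) =
    trans (+-cong (zeta-+ _ _ A B) (zeta-+ _ _ A B)) (interchange _ _ _ _)
  zeta-+ {suc n} f g (inside ∷ A)  (outside ∷ B) =
    trans (+-cong (trans (+-cong (zeta-+ _ _ A B) (zeta-+ _ _ A B)) (interchange _ _ _ _)) (zeta-+ _ _ A B))
          (interchange _ _ _ _)
  zeta-+ {suc n} f g (inside ∷ A)  (inside ∷ B)  = sym (+-identityʳ _)

  zeta-neg : ∀ {n} (f : Subset n → Subset n → Carrier) A B → zeta (λ X Y → - f X Y) A B ≈ - zeta f A B
  zeta-neg {zero}  f []            []            = refl
  zeta-neg {suc n} f (outside ∷ A) (inside ∷ B)  = zeta-neg _ A B
  zeta-neg {suc n} f (outside ∷ A) (outside ∷ B) =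
    trans (+-cong (zeta-neg _ A B) (zeta-neg _ A B)) (⁻¹-∙-comm _ _)
  zeta-neg {suc n} f (inside ∷ A)  (outside ∷ B) =
    trans (+-cong (trans (+-cong (zeta-neg _ A B) (zeta-neg _ A B)) (⁻¹-∙-comm _ _)) (zeta-neg _ A B))
          (⁻¹-∙-comm _ _)
  zeta-neg {suc n} f (inside ∷ A)  (inside ∷ B)  = sym ε⁻¹≈ε

  x+[y-x]≈y : ∀ x y → x + (y - x) ≈ y
  x+[y-x]≈y x y = trans (sym (+-assoc x y (- x))) (xyx⁻¹≈y x y)

  möbius-zeta : ∀ {n} (m : Subset n → Subset n → Carrier) A B → Disjoint A B → möbius (zeta m) A B ≈ m A B
  möbius-zeta {zero}  m []            []            d = möbius-[] (zeta m)
  möbius-zeta {suc n} m (outside ∷ A) (inside ∷ B)  d =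
    trans (möbius-oi (zeta m) A B) (möbius-zeta (slice outside inside m) A B (∷-injectiveʳ d))
  möbius-zeta {suc n} m (outside ∷ A) (outside ∷ B) d = begin
      möbius (zeta m) (outside ∷ A) (outside ∷ B)
    ≈⟨ möbius-oo (zeta m) A B ⟩
      möbius (λ X Y → ζoi X Y + ζoo X Y) A B - möbius ζoi A B
    ≈⟨ +-cong (möbius-+ ζoi ζoo A B) refl ⟩
      möbius ζoi A B + möbius ζoo A B - möbius ζoi A B
    ≈⟨ xyx⁻¹≈y _ _ ⟩
      möbius ζoo A B
    ≈⟨ möbius-zeta (slice outside outside m) A B (∷-injectiveʳ d) ⟩
      m (outside ∷ A) (outside ∷ B) ∎
    where
      ζoi = zeta (slice outside inside m)
      ζoo = zeta (slice outside outside m)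
  möbius-zeta {suc n} m (inside ∷ A)  (outside ∷ B) d = begin
      möbius (zeta m) (inside ∷ A) (outside ∷ B)
    ≈⟨ möbius-io (zeta m) A B ⟩
      möbius (λ X Y → ζoi X Y + ζoo X Y + ζio X Y) A B - möbius (λ X Y → ζoi X Y + ζoo X Y) A B
    ≈⟨ +-cong (möbius-+ (λ X Y → ζoi X Y + ζoo X Y) ζio A B) refl ⟩
      möbius (λ X Y → ζoi X Y + ζoo X Y) A B + möbius ζio A B - möbius (λ X Y → ζoi X Y + ζoo X Y) A B
    ≈⟨ xyx⁻¹≈y _ _ ⟩
      möbius ζio A B
    ≈⟨ möbius-zeta (slice inside outside m) A B (∷-injectiveʳ d) ⟩
      m (inside ∷ A) (outside ∷ B) ∎
    where
      ζoi = zeta (slice outside inside m)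
      ζoo = zeta (slice outside outside m)
      ζio = zeta (slice inside outside m)
  möbius-zeta {suc n} m (inside ∷ A)  (inside ∷ B)  d = ⊥-elim (¬disjoint-inside d)

  zeta-möbius : ∀ {n} (v : Subset n → Subset n → Carrier) A B → Disjoint A B → zeta (möbius v) A B ≈ v A B

  zeta-möbius-oi : ∀ {n} (v : Subset (suc n) → Subset (suc n) → Carrier) A B → Disjoint A B →
    zeta (slice outside inside (möbius v)) A B ≈ slice outside inside v A B
  zeta-möbius-oi v A B d =
    trans (zeta-cong (λ X Y _ → möbius-oi v X Y) A B d) (zeta-möbius (slice outside inside v) A B d)

  zeta-möbius-oo : ∀ {n} (v : Subset (suc n) → Subset (suc n) → Carrier) A B → Disjoint A B →
    zeta (slice outside outside (möbius v)) A B ≈ slice outside outside v A B - slice outside inside v A B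
  zeta-möbius-oo v A B d =
    trans (zeta-cong (λ X Y _ → möbius-oo v X Y) A B d)
     (trans (zeta-+ _ _ A B)
            (+-cong (zeta-möbius (slice outside outside v) A B d)
                    (trans (zeta-neg _ A B) (-‿cong (zeta-möbius (slice outside inside v) A B d)))))

  zeta-möbius-io : ∀ {n} (v : Subset (suc n) → Subset (suc n) → Carrier) A B → Disjoint A B →
    zeta (slice inside outside (möbius v)) A B ≈ slice inside outside v A B - slice outside outside v A B
  zeta-möbius-io v A B d =
    trans (zeta-cong (λ X Y _ → möbius-io v X Y) A B d)
     (trans (zeta-+ _ _ A B)
            (+-cong (zeta-möbius (slice inside outside v) A B d)
                    (trans (zeta-neg _ A B) (-‿cong (zeta-möbius (slice outside outside v) A B d)))))

  zeta-möbius {zero}  v []            []            d = möbius-[] v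
  zeta-möbius {suc n} v (outside ∷ A) (inside ∷ B)  d = zeta-möbius-oi v A B (∷-injectiveʳ d)
  zeta-möbius {suc n} v (outside ∷ A) (outside ∷ B) d =
    trans (+-cong (zeta-möbius-oi v A B (∷-injectiveʳ d)) (zeta-möbius-oo v A B (∷-injectiveʳ d)))
          (x+[y-x]≈y _ _)
  zeta-möbius {suc n} v (inside ∷ A)  (outside ∷ B) d =
    trans (+-cong (trans (+-cong (zeta-möbius-oi v A B (∷-injectiveʳ d)) (zeta-möbius-oo v A B (∷-injectiveʳ d)))
                         (x+[y-x]≈y _ _))
                  (zeta-möbius-io v A B (∷-injectiveʳ d)))
          (x+[y-x]≈y _ _)
  zeta-möbius {suc n} v (inside ∷ A)  (inside ∷ B)  d = ⊥-elim (¬disjoint-inside d)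

  -- k-additivity

  -- The paper's condition |B| < n − k, stated without truncated subtraction.
  Additive : ℕ → ∀ {n} → (Subset n → Subset n → Carrier) → Set
  Additive k {n} m = ∀ X Y → Disjoint X Y → k ℕ.+ ∣ Y ∣ < n → m X Y ≈ 0#

  additive-suc : ∀ {k n} {m : Subset n → Subset n → Carrier} → Additive k m → Additive (suc k) m
  additive-suc add X Y d lt = add X Y d (ℕ.<-trans (ℕ.n<1+n _) lt)

  additive-oi : ∀ {k n} {m : Subset (suc n) → Subset (suc n) → Carrier} →
                Additive k m → Additive k (slice outside inside m)
  additive-oi {k} {n} add X Y d lt =
    add _ _ (cong (outside ∷_) d) (P.subst (_< suc n) (P.sym (ℕ.+-suc k ∣ Y ∣)) (s≤s lt))

  additive-oo : ∀ {k n} {m : Subset (suc n) → Subset (suc n) → Carrier} →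
                Additive (suc k) m → Additive k (slice outside outside m)
  additive-oo add X Y d lt = add _ _ (cong (outside ∷_) d) (s≤s lt)

  additive-io : ∀ {k n} {m : Subset (suc n) → Subset (suc n) → Carrier} →
                Additive (suc k) m → Additive k (slice inside outside m)
  additive-io add X Y d lt = add _ _ (cong (outside ∷_) d) (s≤s lt)

  additive-0-oo≈0 : ∀ {n} {m : Subset (suc n) → Subset (suc n) → Carrier} → Additive 0 m →
                    ∀ X Y → Disjoint X Y → slice outside outside m X Y ≈ 0#
  additive-0-oo≈0 add X Y d = add _ _ (cong (outside ∷_) d) (s≤s (∣p∣≤n Y))

  additive-0-io≈0 : ∀ {n} {m : Subset (suc n) → Subset (suc n) → Carrier} → Additive 0 m →
                    ∀ X Y → Disjoint X Y → slice inside outside m X Y ≈ 0#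
  additive-0-io≈0 add X Y d = add _ _ (cong (outside ∷_) d) (s≤s (∣p∣≤n Y))

  zeta-0-additive : ∀ {n} (m : Subset n → Subset n → Carrier) → Additive 0 m →
                    ∀ A B → Disjoint A B → zeta m A B ≈ m ⊥ ⊤
  zeta-0-additive {zero}  m add []            []            d = refl
  zeta-0-additive {suc n} m add (outside ∷ A) (inside ∷ B)  d = zeta-0-additive _ (additive-oi add) A B (∷-injectiveʳ d)
  zeta-0-additive {suc n} m add (outside ∷ A) (outside ∷ B) d =
    trans (+-cong (zeta-0-additive _ (additive-oi add) A B (∷-injectiveʳ d))
                  (zeta-≈0 (additive-0-oo≈0 add) A B (∷-injectiveʳ d)))
          (+-identityʳ _)
  zeta-0-additive {suc n} m add (inside ∷ A)  (outside ∷ B) d =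
    trans (+-cong (trans (+-cong (zeta-0-additive _ (additive-oi add) A B (∷-injectiveʳ d))
                                 (zeta-≈0 (additive-0-oo≈0 add) A B (∷-injectiveʳ d)))
                         (+-identityʳ _))
                  (zeta-≈0 (additive-0-io≈0 add) A B (∷-injectiveʳ d)))
          (+-identityʳ _)
  zeta-0-additive {suc n} m add (inside ∷ A)  (inside ∷ B)  d = ⊥-elim (¬disjoint-inside d)

  zeta-1-additive : ∀ {n} (m : Subset n → Subset n → Carrier) → Additive 1 m → ∀ A B → Disjoint A B →
    zeta m A B ≈ m ⊥ ⊤ + sumIn (∁ B) (λ j → m ⊥ (∁ ⁅ j ⁆)) + sumIn A (λ j → m ⁅ j ⁆ (∁ ⁅ j ⁆))
  zeta-1-additive {zero}  m add []            []            d = sym (trans (+-identityʳ _) (+-identityʳ _))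
  zeta-1-additive {suc n} m add (outside ∷ A) (inside ∷ B)  d =
    trans (zeta-1-additive _ (additive-oi add) A B (∷-injectiveʳ d))
          (sym (+-cong (+-cong refl (reflexive (sumIn-outside∷ (∁ B) _))) (reflexive (sumIn-outside∷ A _))))
  zeta-1-additive {suc n} m add (outside ∷ A) (outside ∷ B) d =
    trans (+-cong (zeta-1-additive _ (additive-oi add) A B (∷-injectiveʳ d))
                  (zeta-0-additive _ (additive-oo add) A B (∷-injectiveʳ d)))
     (trans (regroup _ _ _ _)
      (sym (+-cong (+-cong refl (trans (reflexive (sumIn-inside∷ (∁ B) _)) (+-cong m⊥∁⁅0⁆ refl)))
                   (reflexive (sumIn-outside∷ A _)))))
    where
      m⊥∁⁅0⁆ : m ⊥ (∁ ⁅ zero ⁆) ≈ m ⊥ (outside ∷ ⊤)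
      m⊥∁⁅0⁆ = reflexive (cong (λ S → m ⊥ (outside ∷ S)) ∁⊥≡⊤)
      regroup : ∀ a b c d → (a + b + c) + d ≈ a + (d + b) + c
      regroup = solve 4 (λ a b c d → ((a ⊕ b) ⊕ c) ⊕ d ⊜ (a ⊕ (d ⊕ b)) ⊕ c) refl
  zeta-1-additive {suc n} m add (inside ∷ A)  (outside ∷ B) d =
    trans (+-cong (+-cong (zeta-1-additive _ (additive-oi add) A B (∷-injectiveʳ d))
                          (zeta-0-additive _ (additive-oo add) A B (∷-injectiveʳ d)))
                  (zeta-0-additive _ (additive-io add) A B (∷-injectiveʳ d)))
     (trans (regroup _ _ _ _ _)
      (sym (+-cong (+-cong refl (trans (reflexive (sumIn-inside∷ (∁ B) _)) (+-cong m⊥∁⁅0⁆ refl)))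
                   (trans (reflexive (sumIn-inside∷ A _)) (+-cong m⁅0⁆∁⁅0⁆ refl)))))
    where
      m⊥∁⁅0⁆ : m ⊥ (∁ ⁅ zero ⁆) ≈ m ⊥ (outside ∷ ⊤)
      m⊥∁⁅0⁆ = reflexive (cong (λ S → m ⊥ (outside ∷ S)) ∁⊥≡⊤)
      m⁅0⁆∁⁅0⁆ : m ⁅ zero ⁆ (∁ ⁅ zero ⁆) ≈ m ⁅ zero ⁆ (outside ∷ ⊤)
      m⁅0⁆∁⁅0⁆ = reflexive (cong (λ S → m ⁅ zero ⁆ (outside ∷ S)) ∁⊥≡⊤)
      regroup : ∀ a b c d e → (a + b + c) + d + e ≈ a + (d + b) + (e + c)
      regroup = solve 5 (λ a b c d e → (((a ⊕ b) ⊕ c) ⊕ d) ⊕ e ⊜ (a ⊕ (d ⊕ b)) ⊕ (e ⊕ c)) refl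
  zeta-1-additive {suc n} m add (inside ∷ A)  (inside ∷ B)  d = ⊥-elim (¬disjoint-inside d)

  Δ⁺ : ∀ {n} → (Subset n → Subset n → Carrier) → Fin n → Subset n → Subset n → Carrier
  Δ⁺ m i A B = m ⁅ i ⁆ (∁ ⁅ i ⁆)
             + sumIn (∁ (B ∪ ⁅ i ⁆)) (λ j → m ⁅ i ⁆ (∁ (⁅ i ⁆ ∪ ⁅ j ⁆)))
             + sumIn A (λ j → m (⁅ i ⁆ ∪ ⁅ j ⁆) (∁ (⁅ i ⁆ ∪ ⁅ j ⁆)))

  Δ⁻ : ∀ {n} → (Subset n → Subset n → Carrier) → Fin n → Subset n → Subset n → Carrier
  Δ⁻ m i A B = m ⊥ (∁ ⁅ i ⁆)
             + sumIn (∁ (B ∪ ⁅ i ⁆)) (λ j → m ⊥ (∁ (⁅ i ⁆ ∪ ⁅ j ⁆)))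
             + sumIn A (λ j → m ⁅ j ⁆ (∁ (⁅ i ⁆ ∪ ⁅ j ⁆)))

  1+∣∁[⁅i⁆∪⁅j⁆]∣<n : ∀ {n} (i j : Fin n) → ¬ j ≡ i → 1 ℕ.+ ∣ ∁ (⁅ i ⁆ ∪ ⁅ j ⁆) ∣ < n
  1+∣∁[⁅i⁆∪⁅j⁆]∣<n i j j≢i = ℕ.≤-reflexive (2+∣∁[⁅x⁆∪⁅y⁆]∣≡n i j (j≢i ∘ P.sym))

  x+y+z≈x : ∀ x y z → y ≈ 0# → z ≈ 0# → x + y + z ≈ x
  x+y+z≈x x y z y≈0 z≈0 = trans (+-cong (trans (+-cong refl y≈0) (+-identityʳ x)) z≈0) (+-identityʳ x)

  Δ⁺-1-additive : ∀ {n} (m : Subset n → Subset n → Carrier) → Additive 1 m →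
                  ∀ i A B → i ∉ A → Δ⁺ m i A B ≈ m ⁅ i ⁆ (∁ ⁅ i ⁆)
  Δ⁺-1-additive m add i A B i∉A = x+y+z≈x _ _ _
    (sumIn-≈0 (∁ (B ∪ ⁅ i ⁆)) _ (λ j j∈ → add _ _ (disjoint-∁-∪ˡ ⁅ i ⁆ ⁅ j ⁆)
                                            (1+∣∁[⁅i⁆∪⁅j⁆]∣<n i j (x∈∁[p∪⁅y⁆]⇒x≢y B j∈))))
    (sumIn-≈0 A _ (λ j j∈A → add _ _ (disjoint-∁ (⁅ i ⁆ ∪ ⁅ j ⁆))
                                   (1+∣∁[⁅i⁆∪⁅j⁆]∣<n i j (λ { P.refl → i∉A j∈A }))))

  Δ⁻-1-additive : ∀ {n} (m : Subset n → Subset n → Carrier) → Additive 1 m →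
                  ∀ i A B → i ∉ A → Δ⁻ m i A B ≈ m ⊥ (∁ ⁅ i ⁆)
  Δ⁻-1-additive m add i A B i∉A = x+y+z≈x _ _ _
    (sumIn-≈0 (∁ (B ∪ ⁅ i ⁆)) _ (λ j j∈ → add _ _ (∩-zeroˡ _)
                                            (1+∣∁[⁅i⁆∪⁅j⁆]∣<n i j (x∈∁[p∪⁅y⁆]⇒x≢y B j∈))))
    (sumIn-≈0 A _ (λ j j∈A → add _ _ (disjoint-∁-∪ʳ ⁅ i ⁆ ⁅ j ⁆)
                                   (1+∣∁[⁅i⁆∪⁅j⁆]∣<n i j (λ { P.refl → i∉A j∈A }))))

  sumIn-⊥∪⁅⁆ : ∀ {n} (S : Subset n) (f : Fin n → Subset n → Carrier) →
               sumIn S (λ j → f j (⊥ ∪ ⁅ j ⁆)) ≈ sumIn S (λ j → f j ⁅ j ⁆)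
  sumIn-⊥∪⁅⁆ S f = sumIn-cong S (λ j _ → reflexive (cong (f j) (∪-identityˡ ⁅ j ⁆)))

  Δ⁺-zero : ∀ {n} (m : Subset (suc n) → Subset (suc n) → Carrier) (A B : Subset n) →
    Δ⁺ m zero (outside ∷ A) (outside ∷ B) ≈
      slice inside outside m ⊥ ⊤ + sumIn (∁ B) (λ j → slice inside outside m ⊥ (∁ ⁅ j ⁆))
                                 + sumIn A (λ j → slice inside outside m ⁅ j ⁆ (∁ ⁅ j ⁆))
  Δ⁺-zero m A B = +-cong (+-cong head pairs) singles
    where
      head = reflexive (cong (λ S → m (inside ∷ ⊥) (outside ∷ S)) ∁⊥≡⊤)
      pairs = begin
        sumIn (outside ∷ ∁ (B ∪ ⊥)) (λ j → m ⁅ zero ⁆ (∁ (⁅ zero ⁆ ∪ ⁅ j ⁆)))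
          ≡⟨ sumIn-outside∷ (∁ (B ∪ ⊥)) _ ⟩
        sumIn (∁ (B ∪ ⊥)) (λ j → m (inside ∷ ⊥) (outside ∷ ∁ (⊥ ∪ ⁅ j ⁆)))
          ≡⟨ cong (λ S → sumIn (∁ S) (λ j → m (inside ∷ ⊥) (outside ∷ ∁ (⊥ ∪ ⁅ j ⁆))))
                  (∪-identityʳ B) ⟩
        sumIn (∁ B) (λ j → m (inside ∷ ⊥) (outside ∷ ∁ (⊥ ∪ ⁅ j ⁆)))
          ≈⟨ sumIn-⊥∪⁅⁆ (∁ B) (λ _ S → m (inside ∷ ⊥) (outside ∷ ∁ S)) ⟩
        sumIn (∁ B) (λ j → m (inside ∷ ⊥) (outside ∷ ∁ ⁅ j ⁆)) ∎
      singles = begin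
        sumIn (outside ∷ A) (λ j → m (⁅ zero ⁆ ∪ ⁅ j ⁆) (∁ (⁅ zero ⁆ ∪ ⁅ j ⁆)))
          ≡⟨ sumIn-outside∷ A _ ⟩
        sumIn A (λ j → m (inside ∷ (⊥ ∪ ⁅ j ⁆)) (outside ∷ ∁ (⊥ ∪ ⁅ j ⁆)))
          ≈⟨ sumIn-⊥∪⁅⁆ A (λ _ S → m (inside ∷ S) (outside ∷ ∁ S)) ⟩
        sumIn A (λ j → m (inside ∷ ⁅ j ⁆) (outside ∷ ∁ ⁅ j ⁆)) ∎

  Δ⁻-zero : ∀ {n} (m : Subset (suc n) → Subset (suc n) → Carrier) (A B : Subset n) →
    Δ⁻ m zero (outside ∷ A) (outside ∷ B) ≈
      slice outside outside m ⊥ ⊤ + sumIn (∁ B) (λ j → slice outside outside m ⊥ (∁ ⁅ j ⁆))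
                                  + sumIn A (λ j → slice outside outside m ⁅ j ⁆ (∁ ⁅ j ⁆))
  Δ⁻-zero m A B = +-cong (+-cong head pairs) singles
    where
      head = reflexive (cong (λ S → m (outside ∷ ⊥) (outside ∷ S)) ∁⊥≡⊤)
      pairs = begin
        sumIn (outside ∷ ∁ (B ∪ ⊥)) (λ j → m ⊥ (∁ (⁅ zero ⁆ ∪ ⁅ j ⁆)))
          ≡⟨ sumIn-outside∷ (∁ (B ∪ ⊥)) _ ⟩
        sumIn (∁ (B ∪ ⊥)) (λ j → m (outside ∷ ⊥) (outside ∷ ∁ (⊥ ∪ ⁅ j ⁆)))
          ≡⟨ cong (λ S → sumIn (∁ S) (λ j → m (outside ∷ ⊥) (outside ∷ ∁ (⊥ ∪ ⁅ j ⁆))))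
                  (∪-identityʳ B) ⟩
        sumIn (∁ B) (λ j → m (outside ∷ ⊥) (outside ∷ ∁ (⊥ ∪ ⁅ j ⁆)))
          ≈⟨ sumIn-⊥∪⁅⁆ (∁ B) (λ _ S → m (outside ∷ ⊥) (outside ∷ ∁ S)) ⟩
        sumIn (∁ B) (λ j → m (outside ∷ ⊥) (outside ∷ ∁ ⁅ j ⁆)) ∎
      singles = begin
        sumIn (outside ∷ A) (λ j → m ⁅ j ⁆ (∁ (⁅ zero ⁆ ∪ ⁅ j ⁆)))
          ≡⟨ sumIn-outside∷ A _ ⟩
        sumIn A (λ j → m (outside ∷ ⁅ j ⁆) (outside ∷ ∁ (⊥ ∪ ⁅ j ⁆)))
          ≈⟨ sumIn-⊥∪⁅⁆ A (λ j S → m (outside ∷ ⁅ j ⁆) (outside ∷ ∁ S)) ⟩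
        sumIn A (λ j → m (outside ∷ ⁅ j ⁆) (outside ∷ ∁ ⁅ j ⁆)) ∎

  private
    regroup₃ : ∀ a e s x → a + (e + s) + x ≈ (a + s + x) + e
    regroup₃ = solve 4 (λ a e s x → (a ⊕ (e ⊕ s)) ⊕ x ⊜ ((a ⊕ s) ⊕ x) ⊕ e) refl

    regroup₄ : ∀ a e s p x → a + (e + s) + (p + x) ≈ (a + s + x) + e + p
    regroup₄ = solve 5 (λ a e s p x → (a ⊕ (e ⊕ s)) ⊕ (p ⊕ x) ⊜ (((a ⊕ s) ⊕ x) ⊕ e) ⊕ p) refl

  Δ⁺-oi : ∀ {n} (m : Subset (suc n) → Subset (suc n) → Carrier) i (A B : Subset n) →
    Δ⁺ m (suc i) (outside ∷ A) (inside ∷ B) ≈ Δ⁺ (slice outside inside m) i A B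
  Δ⁺-oi m i A B =
    +-cong (+-cong refl (reflexive (sumIn-outside∷ (∁ (B ∪ ⁅ i ⁆)) _))) (reflexive (sumIn-outside∷ A _))

  Δ⁺-oo : ∀ {n} (m : Subset (suc n) → Subset (suc n) → Carrier) i (A B : Subset n) →
    Δ⁺ m (suc i) (outside ∷ A) (outside ∷ B) ≈
      Δ⁺ (slice outside inside m) i A B + slice outside outside m ⁅ i ⁆ (∁ ⁅ i ⁆)
  Δ⁺-oo m i A B =
    trans (+-cong (+-cong refl (trans (reflexive (sumIn-inside∷ (∁ (B ∪ ⁅ i ⁆)) _)) (+-cong head refl)))
                  (reflexive (sumIn-outside∷ A _)))
          (regroup₃ _ _ _ _)
    where head = reflexive (cong (λ S → m (outside ∷ ⁅ i ⁆) (outside ∷ ∁ S)) (∪-identityʳ ⁅ i ⁆))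

  Δ⁺-io : ∀ {n} (m : Subset (suc n) → Subset (suc n) → Carrier) i (A B : Subset n) →
    Δ⁺ m (suc i) (inside ∷ A) (outside ∷ B) ≈
      Δ⁺ (slice outside inside m) i A B + slice outside outside m ⁅ i ⁆ (∁ ⁅ i ⁆)
                                        + slice inside outside m ⁅ i ⁆ (∁ ⁅ i ⁆)
  Δ⁺-io m i A B =
    trans (+-cong (+-cong refl (trans (reflexive (sumIn-inside∷ (∁ (B ∪ ⁅ i ⁆)) _)) (+-cong headᴮ refl)))
                  (trans (reflexive (sumIn-inside∷ A _)) (+-cong headᴬ refl)))
          (regroup₄ _ _ _ _ _)
    where
      headᴮ = reflexive (cong (λ S → m (outside ∷ ⁅ i ⁆) (outside ∷ ∁ S)) (∪-identityʳ ⁅ i ⁆))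
      headᴬ = reflexive (cong (λ S → m (inside ∷ S) (outside ∷ ∁ S)) (∪-identityʳ ⁅ i ⁆))

  Δ⁻-oi : ∀ {n} (m : Subset (suc n) → Subset (suc n) → Carrier) i (A B : Subset n) →
    Δ⁻ m (suc i) (outside ∷ A) (inside ∷ B) ≈ Δ⁻ (slice outside inside m) i A B
  Δ⁻-oi m i A B =
    +-cong (+-cong refl (reflexive (sumIn-outside∷ (∁ (B ∪ ⁅ i ⁆)) _))) (reflexive (sumIn-outside∷ A _))

  Δ⁻-oo : ∀ {n} (m : Subset (suc n) → Subset (suc n) → Carrier) i (A B : Subset n) →
    Δ⁻ m (suc i) (outside ∷ A) (outside ∷ B) ≈
      Δ⁻ (slice outside inside m) i A B + slice outside outside m ⊥ (∁ ⁅ i ⁆)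
  Δ⁻-oo m i A B =
    trans (+-cong (+-cong refl (trans (reflexive (sumIn-inside∷ (∁ (B ∪ ⁅ i ⁆)) _)) (+-cong head refl)))
                  (reflexive (sumIn-outside∷ A _)))
          (regroup₃ _ _ _ _)
    where head = reflexive (cong (λ S → m (outside ∷ ⊥) (outside ∷ ∁ S)) (∪-identityʳ ⁅ i ⁆))

  Δ⁻-io : ∀ {n} (m : Subset (suc n) → Subset (suc n) → Carrier) i (A B : Subset n) →
    Δ⁻ m (suc i) (inside ∷ A) (outside ∷ B) ≈
      Δ⁻ (slice outside inside m) i A B + slice outside outside m ⊥ (∁ ⁅ i ⁆)
                                        + slice inside outside m ⊥ (∁ ⁅ i ⁆)
  Δ⁻-io m i A B =
    trans (+-cong (+-cong refl (trans (reflexive (sumIn-inside∷ (∁ (B ∪ ⁅ i ⁆)) _)) (+-cong headᴮ refl)))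
                  (trans (reflexive (sumIn-inside∷ A _)) (+-cong headᴬ refl)))
          (regroup₄ _ _ _ _ _)
    where
      headᴮ = reflexive (cong (λ S → m (outside ∷ ⊥) (outside ∷ ∁ S)) (∪-identityʳ ⁅ i ⁆))
      headᴬ = reflexive (cong (λ S → m (inside ∷ ⊥) (outside ∷ ∁ S)) (∪-identityʳ ⁅ i ⁆))

  zeta-∪⁅⁆ˡ : ∀ {n} (m : Subset n → Subset n → Carrier) → Additive 2 m →
              ∀ i A B → Disjoint A B → i ∉ A → i ∉ B → zeta m (A ∪ ⁅ i ⁆) B ≈ zeta m A B + Δ⁺ m i A B

  zeta-∪⁅⁆ˡ-1-additive : ∀ {n} (m : Subset n → Subset n → Carrier) → Additive 1 m →
    ∀ i A B → Disjoint A B → i ∉ A → i ∉ B → zeta m (A ∪ ⁅ i ⁆) B ≈ zeta m A B + m ⁅ i ⁆ (∁ ⁅ i ⁆)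
  zeta-∪⁅⁆ˡ-1-additive m add i A B d i∉A i∉B =
    trans (zeta-∪⁅⁆ˡ m (additive-suc add) i A B d i∉A i∉B) (+-cong refl (Δ⁺-1-additive m add i A B i∉A))

  zeta-∪⁅⁆ˡ m add zero    (inside ∷ A)  B             d i∉A i∉B = ⊥-elim (i∉A here)
  zeta-∪⁅⁆ˡ m add zero    (outside ∷ A) (inside ∷ B)  d i∉A i∉B = ⊥-elim (i∉B here)
  zeta-∪⁅⁆ˡ m add zero    (outside ∷ A) (outside ∷ B) d i∉A i∉B =
    trans (reflexive (cong (λ X → zeta m (inside ∷ X) (outside ∷ B)) (∪-identityʳ A)))
          (+-cong refl (trans (zeta-1-additive _ (additive-io add) A B (∷-injectiveʳ d)) (sym (Δ⁺-zero m A B))))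
  zeta-∪⁅⁆ˡ m add (suc i) (inside ∷ A)  (inside ∷ B)  d i∉A i∉B = ⊥-elim (¬disjoint-inside d)
  zeta-∪⁅⁆ˡ m add (suc i) (outside ∷ A) (inside ∷ B)  d i∉A i∉B =
    trans (zeta-∪⁅⁆ˡ _ (additive-oi add) i A B (∷-injectiveʳ d) (i∉A ∘ there) (i∉B ∘ there))
          (+-cong refl (sym (Δ⁺-oi m i A B)))
  zeta-∪⁅⁆ˡ m add (suc i) (outside ∷ A) (outside ∷ B) d i∉A i∉B = begin
      zeta m (outside ∷ (A ∪ ⁅ i ⁆)) (outside ∷ B)
    ≈⟨ +-cong (zeta-∪⁅⁆ˡ _ (additive-oi add) i A B (∷-injectiveʳ d) (i∉A ∘ there) (i∉B ∘ there))
              (zeta-∪⁅⁆ˡ-1-additive _ (additive-oo add) i A B (∷-injectiveʳ d) (i∉A ∘ there) (i∉B ∘ there)) ⟩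
      (zeta (slice outside inside m) A B + Δ⁺ (slice outside inside m) i A B)
      + (zeta (slice outside outside m) A B + slice outside outside m ⁅ i ⁆ (∁ ⁅ i ⁆))
    ≈⟨ interchange _ _ _ _ ⟩
      zeta m (outside ∷ A) (outside ∷ B)
      + (Δ⁺ (slice outside inside m) i A B + slice outside outside m ⁅ i ⁆ (∁ ⁅ i ⁆))
    ≈⟨ +-cong refl (sym (Δ⁺-oo m i A B)) ⟩
      zeta m (outside ∷ A) (outside ∷ B) + Δ⁺ m (suc i) (outside ∷ A) (outside ∷ B) ∎
  zeta-∪⁅⁆ˡ m add (suc i) (inside ∷ A)  (outside ∷ B) d i∉A i∉B = begin
      zeta m (inside ∷ (A ∪ ⁅ i ⁆)) (outside ∷ B)
    ≈⟨ +-cong (+-cong (zeta-∪⁅⁆ˡ _ (additive-oi add) i A B (∷-injectiveʳ d) (i∉A ∘ there) (i∉B ∘ there))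
                      (zeta-∪⁅⁆ˡ-1-additive _ (additive-oo add) i A B (∷-injectiveʳ d) (i∉A ∘ there) (i∉B ∘ there)))
              (zeta-∪⁅⁆ˡ-1-additive _ (additive-io add) i A B (∷-injectiveʳ d) (i∉A ∘ there) (i∉B ∘ there)) ⟩
      (zeta (slice outside inside m) A B + Δ⁺ (slice outside inside m) i A B)
      + (zeta (slice outside outside m) A B + slice outside outside m ⁅ i ⁆ (∁ ⁅ i ⁆))
      + (zeta (slice inside outside m) A B + slice inside outside m ⁅ i ⁆ (∁ ⁅ i ⁆))
    ≈⟨ trans (+-cong (interchange _ _ _ _) refl) (interchange _ _ _ _) ⟩
      zeta m (inside ∷ A) (outside ∷ B)
      + (Δ⁺ (slice outside inside m) i A B + slice outside outside m ⁅ i ⁆ (∁ ⁅ i ⁆)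
         + slice inside outside m ⁅ i ⁆ (∁ ⁅ i ⁆))
    ≈⟨ +-cong refl (sym (Δ⁺-io m i A B)) ⟩
      zeta m (inside ∷ A) (outside ∷ B) + Δ⁺ m (suc i) (inside ∷ A) (outside ∷ B) ∎

  zeta-∪⁅⁆ʳ : ∀ {n} (m : Subset n → Subset n → Carrier) → Additive 2 m →
              ∀ i A B → Disjoint A B → i ∉ A → i ∉ B → zeta m A (B ∪ ⁅ i ⁆) + Δ⁻ m i A B ≈ zeta m A B

  zeta-∪⁅⁆ʳ-1-additive : ∀ {n} (m : Subset n → Subset n → Carrier) → Additive 1 m →
    ∀ i A B → Disjoint A B → i ∉ A → i ∉ B → zeta m A (B ∪ ⁅ i ⁆) + m ⊥ (∁ ⁅ i ⁆) ≈ zeta m A B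
  zeta-∪⁅⁆ʳ-1-additive m add i A B d i∉A i∉B =
    trans (+-cong refl (sym (Δ⁻-1-additive m add i A B i∉A))) (zeta-∪⁅⁆ʳ m (additive-suc add) i A B d i∉A i∉B)

  zeta-∪⁅⁆ʳ m add zero    (inside ∷ A)  B             d i∉A i∉B = ⊥-elim (i∉A here)
  zeta-∪⁅⁆ʳ m add zero    (outside ∷ A) (inside ∷ B)  d i∉A i∉B = ⊥-elim (i∉B here)
  zeta-∪⁅⁆ʳ m add zero    (outside ∷ A) (outside ∷ B) d i∉A i∉B =
    +-cong (reflexive (cong (zeta (slice outside inside m) A) (∪-identityʳ B)))
           (trans (Δ⁻-zero m A B) (sym (zeta-1-additive _ (additive-oo add) A B (∷-injectiveʳ d))))
  zeta-∪⁅⁆ʳ m add (suc i) (inside ∷ A)  (inside ∷ B)  d i∉A i∉B = ⊥-elim (¬disjoint-inside d)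
  zeta-∪⁅⁆ʳ m add (suc i) (outside ∷ A) (inside ∷ B)  d i∉A i∉B =
    trans (+-cong refl (Δ⁻-oi m i A B))
          (zeta-∪⁅⁆ʳ _ (additive-oi add) i A B (∷-injectiveʳ d) (i∉A ∘ there) (i∉B ∘ there))
  zeta-∪⁅⁆ʳ m add (suc i) (outside ∷ A) (outside ∷ B) d i∉A i∉B = begin
      zeta m (outside ∷ A) (outside ∷ (B ∪ ⁅ i ⁆)) + Δ⁻ m (suc i) (outside ∷ A) (outside ∷ B)
    ≈⟨ +-cong refl (Δ⁻-oo m i A B) ⟩
      (zeta (slice outside inside m) A (B ∪ ⁅ i ⁆) + zeta (slice outside outside m) A (B ∪ ⁅ i ⁆))
      + (Δ⁻ (slice outside inside m) i A B + slice outside outside m ⊥ (∁ ⁅ i ⁆))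
    ≈⟨ interchange _ _ _ _ ⟩
      (zeta (slice outside inside m) A (B ∪ ⁅ i ⁆) + Δ⁻ (slice outside inside m) i A B)
      + (zeta (slice outside outside m) A (B ∪ ⁅ i ⁆) + slice outside outside m ⊥ (∁ ⁅ i ⁆))
    ≈⟨ +-cong (zeta-∪⁅⁆ʳ _ (additive-oi add) i A B (∷-injectiveʳ d) (i∉A ∘ there) (i∉B ∘ there))
              (zeta-∪⁅⁆ʳ-1-additive _ (additive-oo add) i A B (∷-injectiveʳ d) (i∉A ∘ there) (i∉B ∘ there)) ⟩
      zeta m (outside ∷ A) (outside ∷ B) ∎
  zeta-∪⁅⁆ʳ m add (suc i) (inside ∷ A)  (outside ∷ B) d i∉A i∉B = begin
      zeta m (inside ∷ A) (outside ∷ (B ∪ ⁅ i ⁆)) + Δ⁻ m (suc i) (inside ∷ A) (outside ∷ B)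
    ≈⟨ +-cong refl (Δ⁻-io m i A B) ⟩
      (zeta (slice outside inside m) A (B ∪ ⁅ i ⁆) + zeta (slice outside outside m) A (B ∪ ⁅ i ⁆)
       + zeta (slice inside outside m) A (B ∪ ⁅ i ⁆))
      + (Δ⁻ (slice outside inside m) i A B + slice outside outside m ⊥ (∁ ⁅ i ⁆)
         + slice inside outside m ⊥ (∁ ⁅ i ⁆))
    ≈⟨ trans (interchange _ _ _ _) (+-cong (interchange _ _ _ _) refl) ⟩
      (zeta (slice outside inside m) A (B ∪ ⁅ i ⁆) + Δ⁻ (slice outside inside m) i A B)
      + (zeta (slice outside outside m) A (B ∪ ⁅ i ⁆) + slice outside outside m ⊥ (∁ ⁅ i ⁆))
      + (zeta (slice inside outside m) A (B ∪ ⁅ i ⁆) + slice inside outside m ⊥ (∁ ⁅ i ⁆))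
    ≈⟨ +-cong (+-cong (zeta-∪⁅⁆ʳ _ (additive-oi add) i A B (∷-injectiveʳ d) (i∉A ∘ there) (i∉B ∘ there))
                      (zeta-∪⁅⁆ʳ-1-additive _ (additive-oo add) i A B (∷-injectiveʳ d) (i∉A ∘ there) (i∉B ∘ there)))
              (zeta-∪⁅⁆ʳ-1-additive _ (additive-io add) i A B (∷-injectiveʳ d) (i∉A ∘ there) (i∉B ∘ there)) ⟩
      zeta m (inside ∷ A) (outside ∷ B) ∎

  zeta-⊥⊤ : ∀ {n} (m : Subset n → Subset n → Carrier) → zeta m ⊥ ⊤ ≈ m ⊥ ⊤
  zeta-⊥⊤ {zero}  m = refl
  zeta-⊥⊤ {suc n} m = zeta-⊥⊤ (slice outside inside m)

  zeta-⊥⊥ : ∀ {n} (m : Subset n → Subset n → Carrier) → zeta m ⊥ ⊥ ≈ sumL (subsets n) (m ⊥)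
  zeta-⊥⊥ {zero}  m = sym (+-identityʳ _)
  zeta-⊥⊥ {suc n} m = trans (+-cong (zeta-⊥⊥ (slice outside inside m)) (zeta-⊥⊥ (slice outside outside m)))
                            (trans (+-comm _ _) (sym (sumL-subsets-suc (m ⊥))))

  zeta-⊤⊥ : ∀ {n} (m : Subset n → Subset n → Carrier) →
            zeta m ⊤ ⊥ ≈ sumL (subsets n) (λ A → sumL (filter (disjoint? A) (subsets n)) (m A))
  zeta-⊤⊥ {zero}  m = sym (trans (+-identityʳ _) (+-identityʳ _))
  zeta-⊤⊥ {suc n} m = begin
      zeta (slice outside inside m) ⊤ ⊥ + zeta (slice outside outside m) ⊤ ⊥ + zeta (slice inside outside m) ⊤ ⊥
    ≈⟨ +-cong (trans (+-cong (zeta-⊤⊥ (slice outside inside m)) (zeta-⊤⊥ (slice outside outside m))) (+-comm _ _))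
              (zeta-⊤⊥ (slice inside outside m)) ⟩
      total (slice outside outside m) + total (slice outside inside m) + total (slice inside outside m)
    ≈⟨ +-cong (sym (sumL-+ (subsets n) _ _)) (sym (sumL-cong (subsets n) (λ A → +-identityʳ _))) ⟩
      sumL (subsets n) (λ A → row (slice outside outside m) A + row (slice outside inside m) A)
      + sumL (subsets n) (λ A → row (slice inside outside m) A + 0#)
    ≈⟨ +-cong (sumL-cong (subsets n) (λ A → sym (splitᵒ A)))
              (sumL-cong (subsets n) (λ A → sym (splitⁱ A))) ⟩
      sumL (subsets n) (λ A → sumL (filter (disjoint? (outside ∷ A)) (subsets (suc n))) (m (outside ∷ A)))
      + sumL (subsets n) (λ A → sumL (filter (disjoint? (inside ∷ A)) (subsets (suc n))) (m (inside ∷ A)))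
    ≈⟨ sym (sumL-subsets-suc (λ A → sumL (filter (disjoint? A) (subsets (suc n))) (m A))) ⟩
      sumL (subsets (suc n)) (λ A → sumL (filter (disjoint? A) (subsets (suc n))) (m A)) ∎
    where
      row : (Subset n → Subset n → Carrier) → Subset n → Carrier
      row w A = sumL (filter (disjoint? A) (subsets n)) (w A)
      total : (Subset n → Subset n → Carrier) → Carrier
      total w = sumL (subsets n) (row w)
      splitᵒ : ∀ A → sumL (filter (disjoint? (outside ∷ A)) (subsets (suc n))) (m (outside ∷ A))
                     ≈ row (slice outside outside m) A + row (slice outside inside m) A
      splitᵒ A = trans (sumL-filter-subsets-suc (disjoint? (outside ∷ A)) (m (outside ∷ A)))
        (reflexive (cong₂ (λ l l' → sumL l (slice outside outside m A) + sumL l' (slice outside inside m A))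
                          (filter-does-cong _ (disjoint? A) (subsets n) (λ _ → P.refl))
                          (filter-does-cong _ (disjoint? A) (subsets n) (λ _ → P.refl))))
      splitⁱ : ∀ A → sumL (filter (disjoint? (inside ∷ A)) (subsets (suc n))) (m (inside ∷ A))
                     ≈ row (slice inside outside m) A + 0#
      splitⁱ A = trans (sumL-filter-subsets-suc (disjoint? (inside ∷ A)) (m (inside ∷ A)))
        (reflexive (cong₂ (λ l l' → sumL l (slice inside outside m A) + sumL l' (slice inside inside m A))
                          (filter-does-cong _ (disjoint? A) (subsets n) (λ _ → P.refl))
                          (filter-does-false _ (subsets n) (λ _ → P.refl))))

  sumQ≈zeta-⊤⊥ : ∀ {n} (m : Subset n → Subset n → Carrier) → sumQ m ≈ zeta m ⊤ ⊥
  sumQ≈zeta-⊤⊥ {n} m =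
    trans (sumL-filter-cartesianProduct (λ p → disjoint? (proj₁ p) (proj₂ p)) (subsets n) (subsets n) _)
          (sym (zeta-⊤⊥ m))

  -- Isotonicity from unit steps

  Isotone : ∀ {n} → (Subset n → Subset n → Carrier) → Set
  Isotone g = ∀ A B C D → Disjoint A B → Disjoint C D → A ⊆ C → D ⊆ B → g A B ≤ g C D

  isotone-resp : ∀ {n} {f g : Subset n → Subset n → Carrier} → (∀ A B → Disjoint A B → f A B ≈ g A B) →
                 Isotone f → Isotone g
  isotone-resp f≈g iso A B C D dAB dCD A⊆C D⊆B =
    O.≲-respʳ-≈ (f≈g C D dCD) (O.≲-respˡ-≈ (f≈g A B dAB) (iso A B C D dAB dCD A⊆C D⊆B))

  GrowsOnInsertˡ : ∀ {n} → (Subset n → Subset n → Carrier) → Set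
  GrowsOnInsertˡ g = ∀ i A B → Disjoint A B → i ∉ A → i ∉ B → g A B ≤ g (A ∪ ⁅ i ⁆) B

  ShrinksOnInsertʳ : ∀ {n} → (Subset n → Subset n → Carrier) → Set
  ShrinksOnInsertʳ g = ∀ i A B → Disjoint A B → i ∉ A → i ∉ B → g A (B ∪ ⁅ i ⁆) ≤ g A B

  -- The slice at the heads of (A , B) inherits both unit steps, and the heads are then
  -- moved from (x , y) to (x' , y') by at most two unit steps at position zero.
  isotone-from-unit-steps : ∀ {n} (g : Subset n → Subset n → Carrier) →
                            GrowsOnInsertˡ g → ShrinksOnInsertʳ g → Isotone g
  isotone-from-unit-steps {zero}  g grow shrink [] [] [] [] _ _ _ _ = O.refl
  isotone-from-unit-steps {suc n} g grow shrink (x ∷ A) (y ∷ B) (x' ∷ C) (y' ∷ D) dAB dCD A⊆C D⊆B =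
    O.trans (isotone-from-unit-steps (slice x y g) grow′ shrink′ A B C D
               (∷-injectiveʳ dAB) (∷-injectiveʳ dCD) (drop-∷-⊆ A⊆C) (drop-∷-⊆ D⊆B))
            (move-head x y x' y' (∷-injectiveˡ dAB) (∷-injectiveˡ dCD) A⊆C D⊆B)
    where
      grow′ : GrowsOnInsertˡ (slice x y g)
      grow′ i A B d i∉A i∉B =
        P.subst (λ z → g (x ∷ A) (y ∷ B) ≤ g (z ∷ (A ∪ ⁅ i ⁆)) (y ∷ B)) (∨-identityʳ x)
          (grow (suc i) (x ∷ A) (y ∷ B) (cong₂ _∷_ (∷-injectiveˡ dAB) d) (i∉A ∘ drop-there) (i∉B ∘ drop-there))
      shrink′ : ShrinksOnInsertʳ (slice x y g)
      shrink′ i A B d i∉A i∉B =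
        P.subst (λ z → g (x ∷ A) (z ∷ (B ∪ ⁅ i ⁆)) ≤ g (x ∷ A) (y ∷ B)) (∨-identityʳ y)
          (shrink (suc i) (x ∷ A) (y ∷ B) (cong₂ _∷_ (∷-injectiveˡ dAB) d) (i∉A ∘ drop-there) (i∉B ∘ drop-there))
      insert-zeroˡ : g (outside ∷ C) (outside ∷ D) ≤ g (inside ∷ C) (outside ∷ D)
      insert-zeroˡ = P.subst (λ z → g (outside ∷ C) (outside ∷ D) ≤ g (inside ∷ z) (outside ∷ D)) (∪-identityʳ C)
        (grow zero (outside ∷ C) (outside ∷ D) (cong (outside ∷_) (∷-injectiveʳ dCD)) (λ ()) (λ ()))
      insert-zeroʳ : g (outside ∷ C) (inside ∷ D) ≤ g (outside ∷ C) (outside ∷ D)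
      insert-zeroʳ = P.subst (λ z → g (outside ∷ C) (inside ∷ z) ≤ g (outside ∷ C) (outside ∷ D)) (∪-identityʳ D)
        (shrink zero (outside ∷ C) (outside ∷ D) (cong (outside ∷_) (∷-injectiveʳ dCD)) (λ ()) (λ ()))
      move-head : ∀ x y x' y' → x ∧ y ≡ false → x' ∧ y' ≡ false →
                  (x ∷ A) ⊆ (x' ∷ C) → (y' ∷ D) ⊆ (y ∷ B) →
                  g (x ∷ C) (y ∷ D) ≤ g (x' ∷ C) (y' ∷ D)
      move-head false false false false _ _  _ _ = O.refl
      move-head false false false true  _ _  _ D⊆B with D⊆B here
      ... | ()
      move-head false false true  false _ _  _ _ = insert-zeroˡ
      move-head false false true  true  _ () _ _
      move-head false true  false false _ _  _ _ = insert-zeroʳ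
      move-head false true  false true  _ _  _ _ = O.refl
      move-head false true  true  false _ _  _ _ = O.trans insert-zeroʳ insert-zeroˡ
      move-head false true  true  true  _ () _ _
      move-head true  false false _     _ _  A⊆C _ with A⊆C here
      ... | ()
      move-head true  false true  false _ _  _ _ = O.refl
      move-head true  false true  true  _ () _ _
      move-head true  true  _     _     () _ _ _

  IsMöbiusOfNormalizedBiCapacity : ∀ {n} → (Subset n → Subset n → Carrier) → Set
  IsMöbiusOfNormalizedBiCapacity {n} m =
    Σ (Subset n → Subset n → Carrier) λ v →
      IsNormalizedBiCapacity v × (∀ A B → Disjoint A B → m A B ≈ möbius v A B)

  NormalizationConditions : ∀ {n} → (Subset n → Subset n → Carrier) → Set
  NormalizationConditions {n} m =
    (sumQ m ≈ 1#) × (sumL (filter (_⊂? ⊤) (subsets n)) (m ⊥) ≈ 1#) × (m ⊥ ⊤ ≈ - 1#)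

  MonotonicityConditions : ∀ {n} → (Subset n → Subset n → Carrier) → Set
  MonotonicityConditions m =
    ∀ i A B → Disjoint A B → i ∉ A → i ∉ B → (0# ≤ Δ⁺ m i A B) × (0# ≤ Δ⁻ m i A B)

  NormalizedValues : ∀ {n} → (Subset n → Subset n → Carrier) → Set
  NormalizedValues v = v ⊥ ⊥ ≈ 0# × v ⊤ ⊥ ≈ 1# × v ⊥ ⊤ ≈ - 1#

  normalizationConditions⇔normalizedValues : ∀ {n} (m : Subset n → Subset n → Carrier) →
    NormalizationConditions m ⇔ NormalizedValues (zeta m)
  normalizationConditions⇔normalizedValues {n} m = mk⇔
    (λ (sumQ≈1 , sum⊂⊤≈1 , m⊥⊤≈-1) →
       trans (zeta-⊥⊥ m) (trans (sym (sumL-⊂⊤+⊤ (m ⊥))) (trans (+-cong sum⊂⊤≈1 m⊥⊤≈-1) (-‿inverseʳ 1#))) ,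
       trans (sym (sumQ≈zeta-⊤⊥ m)) sumQ≈1 ,
       trans (zeta-⊥⊤ m) m⊥⊤≈-1)
    (λ (ζ⊥⊥≈0 , ζ⊤⊥≈1 , ζ⊥⊤≈-1) →
       let m⊥⊤≈-1 = trans (sym (zeta-⊥⊤ m)) ζ⊥⊤≈-1 in
       trans (sumQ≈zeta-⊤⊥ m) ζ⊤⊥≈1 ,
       sum⊂⊤≈1 m⊥⊤≈-1 (trans (sumL-⊂⊤+⊤ (m ⊥)) (trans (sym (zeta-⊥⊥ m)) ζ⊥⊥≈0)) ,
       m⊥⊤≈-1)
    where
      sum⊂⊤≈1 : m ⊥ ⊤ ≈ - 1# → sumL (filter (_⊂? ⊤) (subsets n)) (m ⊥) + m ⊥ ⊤ ≈ 0# →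
                sumL (filter (_⊂? ⊤) (subsets n)) (m ⊥) ≈ 1#
      sum⊂⊤≈1 m⊥⊤≈-1 s+m⊥⊤≈0 =
        trans (inverseˡ-unique _ _ s+m⊥⊤≈0) (trans (-‿cong m⊥⊤≈-1) (⁻¹-involutive 1#))

  0≤y⇒x≤x+y : ∀ {x y} → 0# ≤ y → x ≤ x + y
  0≤y⇒x≤x+y {x} {y} 0≤y = O.≲-respˡ-≈ (+-identityˡ x) (O.≲-respʳ-≈ (+-comm y x) (+-monoˡ-≤ x 0≤y))

  x≤y⇒0≤y-x : ∀ {x y} → x ≤ y → 0# ≤ y - x
  x≤y⇒0≤y-x {x} x≤y = O.≲-respˡ-≈ (-‿inverseʳ x) (+-monoˡ-≤ (- x) x≤y)

  monotonicityConditions⇔isotone : ∀ {n} (m : Subset n → Subset n → Carrier) → Additive 2 m →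
    MonotonicityConditions m ⇔ Isotone (zeta m)
  monotonicityConditions⇔isotone m add = mk⇔
    (λ Δ≥0 → isotone-from-unit-steps (zeta m)
       (λ i A B d i∉A i∉B → O.≲-respʳ-≈ (sym (zeta-∪⁅⁆ˡ m add i A B d i∉A i∉B))
                                          (0≤y⇒x≤x+y (proj₁ (Δ≥0 i A B d i∉A i∉B))))
       (λ i A B d i∉A i∉B → O.≲-respʳ-≈ (zeta-∪⁅⁆ʳ m add i A B d i∉A i∉B)
                                          (0≤y⇒x≤x+y (proj₂ (Δ≥0 i A B d i∉A i∉B)))))
    (λ iso i A B d i∉A i∉B →
       let d⁺ = disjoint-∪⁅⁆ˡ d i∉B
           d⁻ = disjoint-∪⁅⁆ʳ d i∉A
       in O.≲-respʳ-≈ (trans (+-cong (zeta-∪⁅⁆ˡ m add i A B d i∉A i∉B) refl) (xyx⁻¹≈y _ _))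
                      (x≤y⇒0≤y-x (iso A B (A ∪ ⁅ i ⁆) B d d⁺ (p⊆p∪q ⁅ i ⁆) id)) ,
          O.≲-respʳ-≈ (trans (+-cong (sym (zeta-∪⁅⁆ʳ m add i A B d i∉A i∉B)) refl) (xyx⁻¹≈y _ _))
                      (x≤y⇒0≤y-x (iso A (B ∪ ⁅ i ⁆) A B d⁻ d id (p⊆p∪q ⁅ i ⁆))))

  isMöbiusOfNormalizedBiCapacity⇔ : ∀ {n} (m : Subset n → Subset n → Carrier) →
    IsMöbiusOfNormalizedBiCapacity m ⇔ (Isotone (zeta m) × NormalizedValues (zeta m))
  isMöbiusOfNormalizedBiCapacity⇔ m = mk⇔
    (λ (v , ((iso , v⊥⊥≈0) , v⊤⊥≈1 , v⊥⊤≈-1) , m≈möbius-v) →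
       let v≈ζ : ∀ A B → Disjoint A B → v A B ≈ zeta m A B
           v≈ζ A B d = sym (trans (zeta-cong m≈möbius-v A B d) (zeta-möbius v A B d))
       in isotone-resp v≈ζ iso ,
          trans (sym (v≈ζ ⊥ ⊥ (∩-zeroˡ ⊥))) v⊥⊥≈0 ,
          trans (sym (v≈ζ ⊤ ⊥ (∩-zeroʳ ⊤))) v⊤⊥≈1 ,
          trans (sym (v≈ζ ⊥ ⊤ (∩-zeroˡ ⊤))) v⊥⊤≈-1)
    (λ (iso , ζ⊥⊥≈0 , ζ⊤⊥≈1 , ζ⊥⊤≈-1) →
       zeta m , ((iso , ζ⊥⊥≈0) , ζ⊤⊥≈1 , ζ⊥⊤≈-1) , λ A B d → sym (möbius-zeta m A B d))

proposition6 :
    (R : OrderedCommRing) (n : ℕ) →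
    let open OrderedCommRing R
        open Bi R
    in (m : Subset n → Subset n → Carrier) →
       (∀ A B → Disjoint A B → ∣ B ∣ < n ∸ 2 → m A B ≈ 0#) →
       (Σ (Subset n → Subset n → Carrier) λ v →
          IsNormalizedBiCapacity v × (∀ A B → Disjoint A B → m A B ≈ möbius v A B))
       ⇔
       (((sumQ m ≈ 1#)
          × (sumL (filter (_⊂? ⊤) (subsets n)) (m ⊥) ≈ 1#)
          × (m ⊥ ⊤ ≈ - 1#))
        × (∀ i A B → Disjoint A B → i ∉ A → i ∉ B →
             (0# ≤ (m ⁅ i ⁆ (∁ ⁅ i ⁆)
                    + sumIn (∁ (B ∪ ⁅ i ⁆)) (λ j → m ⁅ i ⁆ (∁ (⁅ i ⁆ ∪ ⁅ j ⁆)))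
                    + sumIn A (λ j → m (⁅ i ⁆ ∪ ⁅ j ⁆) (∁ (⁅ i ⁆ ∪ ⁅ j ⁆)))))
             × (0# ≤ (m ⊥ (∁ ⁅ i ⁆)
                    + sumIn (∁ (B ∪ ⁅ i ⁆)) (λ j → m ⊥ (∁ (⁅ i ⁆ ∪ ⁅ j ⁆)))
                    + sumIn A (λ j → m ⁅ j ⁆ (∁ (⁅ i ⁆ ∪ ⁅ j ⁆)))))))
proposition6 R n m vanish = mk⇔
  (λ h → let (iso , values) = to (isMöbiusOfNormalizedBiCapacity⇔ R m) h
         in from (normalizationConditions⇔normalizedValues R m) values ,
            from (monotonicityConditions⇔isotone R m 2-additive) iso)
  (λ (normalization , monotonicity) →
     from (isMöbiusOfNormalizedBiCapacity⇔ R m)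
          (to (monotonicityConditions⇔isotone R m 2-additive) monotonicity ,
           to (normalizationConditions⇔normalizedValues R m) normalization))
  where
    open Equivalence
    2-additive : Additive R 2 m
    2-additive X Y d 2+∣Y∣<n = vanish X Y d (2+m<n⇒m<n∸2 2+∣Y∣<n)
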